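{- Let $(A,B)$ be an invertible Jones pair of $n\times n$ matrices with $A$ symmetric, let $d^2=n$, and let \[ V=\begin{pmatrix} dA & -dA & B^{(-)} & B^{(-)}\\ -dA & dA & B^{(-)} & B^{(-)}\\ (B^{(-)})^T & (B^{(-)})^T & dA & -dA\\ (B^{(-)})^T & (B^{(-)})^T & -dA & dA \end{pmatrix}. \] Let $M\in\mathcal B=\{\mathcal M(F,G,H) : F\in\mathcal N_A,\ G,H\in\mathcal N_{A,B}\}$. Then for all $r\in\{2n+1,\dots,4n\}$ and $s\in\{1,\dots,2n\}$, the vector $Ve_r\circ V^{(-)}e_s\in\mathbb C^{4n}$ is an eigenvector of $M$ (here $e_1,\dots,e_{4n}$ is the standard basis of $\mathbb C^{4n}$).
   Context: All matrices are complex. $X\circ Y$ is the Schur product; $X^{(-)}$ is the Schur inverse of a matrix with no zero entries. $W$ ($n\times n$) is type-II if $W(W^{(-)})^T=nI$. For a matrix $C$, $X_C(M)=CM$, $\Delta_C(M)=C\circ M$. A Jones pair is a pair $(A,B)$ of $n\times n$ matrices with $X_A$, $\Delta_B$ invertible, $X_A\Delta_BX_A=\Delta_BX_A\Delta_B$ and $X_A\Delta_{B^T}X_A=\Delta_{B^T}X_A\Delta_{B^T}$; it is invertible if moreover $A$ has no zero entry and $B$ is invertible (equivalently $A,B$ type-II). With $e_1,\dots,e_n$ the standard basis of $\mathbb C^n$, for $P$ invertible and $Q$ without zero entries, $\mathcal N_{P,Q}$ is the set of matrices $M$ such that every $Pe_i\circ Qe_j$ is an eigenvector of $M$, and $\Theta_{P,Q}(M)$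 is the matrix with $M(Pe_i\circ Qe_j)=\Theta_{P,Q}(M)_{ij}(Pe_i\circ Qe_j)$. For type-II $P$, $\mathcal N_P:=\mathcal N_{P,P^{(-)}}$, $\Theta_P:=\Theta_{P,P^{(-)}}$. Standing facts for the definitions: $\mathcal N_{A,B}=\mathcal N_{A,B^T}$ is closed under transposition and $\mathcal N_A=\mathcal N_{B^{(-)}}$. Pairing: for $H\in\mathcal N_{A,B}$, the matrix paired with $H$ is the unique $K$ with $K^T\in\mathcal N_{A,B^T}$ and $\Theta_{A,B}(H)=\Theta_{A,B^T}(K^T)^T$. For $F\in\mathcal N_A$, $G,H\in\mathcal N_{A,B}$, with $K$ paired with $H$, \[ \mathcal M(F,G,H)=\begin{pmatrix} \Theta_A(F)+H & \Theta_A(F)-H & \Theta_{A,B}(G) & \Theta_{A,B}(G)\\ \Theta_A(F)-H & \Theta_A(F)+H & \Theta_{A,B}(G) & \Theta_{A,B}(G)\\ \Theta_{A,B}(G^T)^T & \Theta_{A,B}(G^T)^T & \Theta_{B^{(-)}}(F)+K & \Theta_{B^{(-)}}(F)-K\\ \Theta_{A,B}(G^T)^T & \Theta_{A,B}(G^T)^T & \Theta_{B^{(-)}}(F)-K & \Theta_{B^{(-)}}(F)+K \end{pmatrix}. \] -}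

module Defs where

open import Level using (_⊔_)
open import Data.Nat using (ℕ; zero; suc)
open import Data.Fin using (Fin; remQuot)
open import Data.Product using (Σ; ∃; _×_; _,_; proj₁; proj₂)
open import Data.List using (List; []; _∷_)
open import Data.Vec as V using ([]; _∷_)
open import Relation.Nullary using (¬_)
open import Algebra.Bundles using (CommutativeRing)
import Algebra.Properties.Monoid.Sum as MonoidSum

-- Everything is developed over a commutative ring R (with setoid equality _≈_);
-- the statement additionally assumes R is an algebraically closed field of
-- characteristic 0 (the first-order theory of ℂ).
module Over {c ℓ} (R : CommutativeRing c ℓ) where
  open CommutativeRing R

  IsFieldR : Set (c ⊔ ℓ)
  IsFieldR = (¬ (1# ≈ 0#)) × (∀ x → ¬ (x ≈ 0#) → ∃ λ y → x * y ≈ 1#)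

  fromℕ : ℕ → Carrier
  fromℕ zero    = 0#
  fromℕ (suc k) = 1# + fromℕ k

  CharZero : Set ℓ
  CharZero = ∀ k → ¬ (fromℕ (suc k) ≈ 0#)

  -- evalMonic (c₀ ∷ … ∷ c_{k-1}) x = c₀ + c₁ x + … + c_{k-1} x^{k-1} + x^k
  evalMonic : List Carrier → Carrier → Carrier
  evalMonic []       x = 1#
  evalMonic (a ∷ as) x = a + x * evalMonic as x

  AlgClosed : Set (c ⊔ ℓ)
  AlgClosed = ∀ a as → ∃ λ x → evalMonic (a ∷ as) x ≈ 0#

  Vect : ℕ → Set c
  Vect n = Fin n → Carrier

  Mat : ℕ → ℕ → Set c
  Mat m n = Fin m → Fin n → Carrier

  open MonoidSum +-monoid using (sum)

  infix 4 _≈ᵛ_ _≈ᴹ_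
  infixl 6 _+ᴹ_ _-ᴹ_
  infixl 7 _·_ _*ᵥ_ _⊙_ _⊙ᵥ_ _∙ᵥ_ _∙ᴹ_
  infix 9 _ᵀ

  _≈ᵛ_ : ∀ {n} → Vect n → Vect n → Set ℓ
  u ≈ᵛ v = ∀ i → u i ≈ v i

  _≈ᴹ_ : ∀ {m n} → Mat m n → Mat m n → Set ℓ
  X ≈ᴹ Y = ∀ i j → X i j ≈ Y i j

  _·_ : ∀ {m k n} → Mat m k → Mat k n → Mat m n
  (X · Y) i j = sum (λ l → X i l * Y l j)

  _*ᵥ_ : ∀ {m n} → Mat m n → Vect n → Vect m
  (X *ᵥ v) i = sum (λ l → X i l * v l)

  _⊙_ : ∀ {m n} → Mat m n → Mat m n → Mat m n
  (X ⊙ Y) i j = X i j * Y i j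

  _⊙ᵥ_ : ∀ {n} → Vect n → Vect n → Vect n
  (u ⊙ᵥ v) i = u i * v i

  _∙ᵥ_ : ∀ {n} → Carrier → Vect n → Vect n
  (a ∙ᵥ v) i = a * v i

  _∙ᴹ_ : ∀ {m n} → Carrier → Mat m n → Mat m n
  (a ∙ᴹ X) i j = a * X i j

  _+ᴹ_ : ∀ {m n} → Mat m n → Mat m n → Mat m n
  (X +ᴹ Y) i j = X i j + Y i j

  _-ᴹ_ : ∀ {m n} → Mat m n → Mat m n → Mat m n
  (X -ᴹ Y) i j = X i j - Y i j

  -ᴹ_ : ∀ {m n} → Mat m n → Mat m n
  (-ᴹ X) i j = - X i j

  _ᵀ : ∀ {m n} → Mat m n → Mat n m
  (X ᵀ) i j = X j i

  I : ∀ {n} → Mat n n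
  I i j with i Data.Fin.≟ j
  ... | Relation.Nullary.yes _ = 1#
  ... | Relation.Nullary.no  _ = 0#

  col : ∀ {m n} → Mat m n → Fin n → Vect m
  col X j i = X i j

  Symmetric : ∀ {n} → Mat n n → Set ℓ
  Symmetric X = X ᵀ ≈ᴹ X

  Invertible : ∀ {n} → Mat n n → Set (c ⊔ ℓ)
  Invertible X = ∃ λ Y → ((X · Y) ≈ᴹ I) × ((Y · X) ≈ᴹ I)

  NoZeroEntries : ∀ {m n} → Mat m n → Set ℓ
  NoZeroEntries X = ∀ i j → ¬ (X i j ≈ 0#)

  IsSchurInverse : ∀ {m n} → Mat m n → Mat m n → Set ℓ
  IsSchurInverse X Y = ∀ i j → X i j * Y i j ≈ 1#

  NonZeroVect : ∀ {n} → Vect n → Set ℓ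
  NonZeroVect v = ∃ λ i → ¬ (v i ≈ 0#)

  IsEigenvector : ∀ {n} → Mat n n → Vect n → Set (c ⊔ ℓ)
  IsEigenvector M v = NonZeroVect v × ∃ λ λ′ → (M *ᵥ v) ≈ᵛ (λ′ ∙ᵥ v)

  InN : ∀ {n} → Mat n n → Mat n n → Mat n n → Set (c ⊔ ℓ)
  InN P Q M = ∀ i j → IsEigenvector M (col P i ⊙ᵥ col Q j)

  -- T = Θ_{P,Q}(M)  (T is unique since the vectors P e_i ∘ Q e_j are nonzero)
  IsΘ : ∀ {n} → Mat n n → Mat n n → Mat n n → Mat n n → Set ℓ
  IsΘ P Q M T = ∀ i j → (M *ᵥ (col P i ⊙ᵥ col Q j)) ≈ᵛ (T i j ∙ᵥ (col P i ⊙ᵥ col Q j))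

  -- Jones pairs. X_A invertible ⇔ A invertible; Δ_B invertible ⇔ B has no zero entry.
  -- The braid relations are stated as identities of linear maps on n×n matrices.
  IsJonesPair : ∀ {n} → Mat n n → Mat n n → Set (c ⊔ ℓ)
  IsJonesPair A B =
    Invertible A × NoZeroEntries B
    × (∀ X → (A · (B ⊙ (A · X))) ≈ᴹ (B ⊙ (A · (B ⊙ X))))
    × (∀ X → (A · ((B ᵀ) ⊙ (A · X))) ≈ᴹ ((B ᵀ) ⊙ (A · ((B ᵀ) ⊙ X))))

  IsInvertibleJonesPair : ∀ {n} → Mat n n → Mat n n → Set (c ⊔ ℓ)
  IsInvertibleJonesPair A B = IsJonesPair A B × NoZeroEntries A × Invertible B

  -- 4×4 block matrix; index r ∈ Fin (4 * n) corresponds to block ⌊r/n⌋, offset r mod n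
  -- (rows/columns r = 1..4n of the paper, 0-based here)
  blocks : ∀ {n} → V.Vec (V.Vec (Mat n n) 4) 4 → Mat (4 Data.Nat.* n) (4 Data.Nat.* n)
  blocks {n} Bs r s with remQuot {4} n r | remQuot {4} n s
  ... | (br , ir) | (bs , is) = V.lookup (V.lookup Bs br) bs ir is

  Vmat : ∀ {n} → Carrier → Mat n n → Mat n n → Mat (4 Data.Nat.* n) (4 Data.Nat.* n)
  Vmat d A Binv = blocks
    ( (dA ∷ (-ᴹ dA) ∷ Binv ∷ Binv ∷ [])
    ∷ ((-ᴹ dA) ∷ dA ∷ Binv ∷ Binv ∷ [])
    ∷ ((Binv ᵀ) ∷ (Binv ᵀ) ∷ dA ∷ (-ᴹ dA) ∷ [])
    ∷ ((Binv ᵀ) ∷ (Binv ᵀ) ∷ (-ᴹ dA) ∷ dA ∷ [])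
    ∷ [])
    where dA = d ∙ᴹ A

  -- 𝓜(F,G,H) given ΘAF = Θ_A(F), ΘBF = Θ_{B^(-)}(F), ΘG = Θ_{A,B}(G),
  -- ΘGt = Θ_{A,B}(Gᵀ), H, and K paired with H
  Mmat : ∀ {n} → (ΘAF ΘBF ΘG ΘGt H K : Mat n n) → Mat (4 Data.Nat.* n) (4 Data.Nat.* n)
  Mmat ΘAF ΘBF ΘG ΘGt H K = blocks
    ( ((ΘAF +ᴹ H) ∷ (ΘAF -ᴹ H) ∷ ΘG ∷ ΘG ∷ [])
    ∷ ((ΘAF -ᴹ H) ∷ (ΘAF +ᴹ H) ∷ ΘG ∷ ΘG ∷ [])
    ∷ ((ΘGt ᵀ) ∷ (ΘGt ᵀ) ∷ (ΘBF +ᴹ K) ∷ (ΘBF -ᴹ K) ∷ [])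
    ∷ ((ΘGt ᵀ) ∷ (ΘGt ᵀ) ∷ (ΘBF -ᴹ K) ∷ (ΘBF +ᴹ K) ∷ [])
    ∷ [])

{-# OPTIONS --safe #-}
-- Write r = (br, i) and s = (bs, j) in the 4 × 4 block decomposition. For r in the right and s in the
-- left half, V e_r ∘ V⁽⁻⁾ e_s = (x, -x, y, -y) with x a multiple of A⁽⁻⁾e_j ∘ B⁽⁻⁾e_i and y a multiple
-- of A e_i ∘ Bᵀe_j, and on such vectors 𝓜(F,G,H) acts as (2Hx, -2Hx, 2Ky, -2Ky). So it suffices that
-- x and y are eigenvectors of H and K with one common eigenvalue.
--
-- An invertible Jones pair is "braided": the braid relation says A ∈ 𝒩_{A,B} with Θ_{A,B}(A) = B,
-- A and B are type II (A ∘ (A⁻¹)ᵀ has rank one and unit line sums, so it is J/n), and inverting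
-- A Δ A = Δ A Δ (Δ = diag (B e_c)) gives the braid relation for (A⁽⁻⁾, B⁽⁻⁾) with factor n.
-- For a braided pair (P, Q), a matrix M ∈ 𝒩_{P,Q} is diagonalised, for each a, by the basis
-- (P e_a ∘ Q e_c)_c whose dual basis is (P⁽⁻⁾e_a ∘ Q⁽⁻⁾e_c / n)_c. Hence Mᵀ ∈ 𝒩_{P⁽⁻⁾,Q⁽⁻⁾} with the
-- same eigenvalues, and, using the two braid relations (a star-triangle relation), also
-- M ∈ 𝒩_{P⁽⁻⁾,Q⁽⁻⁾} with eigenvalue matrix (1/n) Q Θᵀ Q⁽⁻⁾. The first gives the eigenvalues of H
-- from (A, B); for K, pass from Kᵀ ∈ 𝒩_{A,Bᵀ} to K ∈ 𝒩_{A⁽⁻⁾,B⁽⁻⁾ᵀ} and then to K ∈ 𝒩_{A,Bᵀ}. The two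
-- eigenvalue matrices are (1/n) B Θᵀ B⁽⁻⁾ and its transpose, as the pairing of H and K requires.
module Submission where

open import Defs
open import Data.Nat using (ℕ)
import Data.Nat as N
open import Data.Fin using (Fin; toℕ)
open import Data.Product using (_×_)
open import Algebra.Bundles using (CommutativeRing)

open import Level using (_⊔_)
open import Data.Fin as F using (suc; punchIn; combine; _↑ˡ_; _↑ʳ_)
import Data.Fin.Properties as FinP
import Data.Nat.Properties as ℕP
open import Data.Product using (Σ; ∃; _,_; proj₁; proj₂)
open import Relation.Binary.PropositionalEquality as ≡ using (_≡_; _≢_)
open import Relation.Nullary using (¬_; yes; no)
open import Data.Empty using (⊥-elim)
open import Data.Vec using (Vec; []; _∷_; lookup)
open import Data.Fin.Patterns using (0F; 1F; 2F; 3F)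

quotient-≥ : ∀ {m n} q (b : Fin m) (k : Fin n) → q N.* n N.≤ toℕ (combine b k) → q N.≤ toℕ b
quotient-≥ {n = n} q b k qn≤bk = ℕP.≤-pred (ℕP.*-cancelˡ-< n q (N.suc (toℕ b)) (begin-strict
  n N.* q                 ≡⟨ ℕP.*-comm n q ⟩
  q N.* n                 ≤⟨ qn≤bk ⟩
  toℕ (combine b k)       ≡⟨ FinP.toℕ-combine b k ⟩
  n N.* toℕ b N.+ toℕ k   <⟨ ℕP.+-monoʳ-< (n N.* toℕ b) (FinP.toℕ<n k) ⟩
  n N.* toℕ b N.+ n       ≡⟨ ℕP.+-comm (n N.* toℕ b) n ⟩
  n N.+ n N.* toℕ b       ≡⟨ ℕP.*-suc n (toℕ b) ⟨
  n N.* N.suc (toℕ b)     ∎))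
  where open ℕP.≤-Reasoning

quotient-< : ∀ {m n} q (b : Fin m) (k : Fin n) → toℕ (combine b k) N.< q N.* n → toℕ b N.< q
quotient-< {n = n} q b k bk<qn = ℕP.*-cancelˡ-< n (toℕ b) q (begin-strict
  n N.* toℕ b             ≤⟨ ℕP.m≤m+n (n N.* toℕ b) (toℕ k) ⟩
  n N.* toℕ b N.+ toℕ k   ≡⟨ FinP.toℕ-combine b k ⟨
  toℕ (combine b k)       <⟨ bk<qn ⟩
  q N.* n                 ≡⟨ ℕP.*-comm q n ⟩
  n N.* q                 ∎)
  where open ℕP.≤-Reasoning

module JonesPairs {c ℓ} (R : CommutativeRing c ℓ) where

  open CommutativeRing R
  open Over R
  open import Algebra.Properties.Semiring.Sum semiring
    using (sum; sum-syntax; sum-cong-≋; sum-remove; sum-replicate-zero; ∑-distrib-+; ∑-comm; *-distribˡ-sum; *-distribʳ-sum)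
  open import Algebra.Solver.Ring.NaturalCoefficients.Default commutativeSemiring
    using (solve; _:*_; _:+_; _:=_)
  open import Algebra.Properties.Ring ring using (-‿distribˡ-*; -‿distribʳ-*; -‿involutive; -‿+-comm; -0#≈0#)
  open import Relation.Binary.Reasoning.Setoid setoid

  *-cancelˡ-invertible : ∀ {a b x y} → a * b ≈ 1# → a * x ≈ a * y → x ≈ y
  *-cancelˡ-invertible {a} {b} {x} {y} ab≈1 ax≈ay = begin
    x            ≈⟨ *-identityˡ x ⟨
    1# * x       ≈⟨ *-congʳ (trans (*-comm b a) ab≈1) ⟨
    (b * a) * x  ≈⟨ *-assoc b a x ⟩
    b * (a * x)  ≈⟨ *-congˡ ax≈ay ⟩
    b * (a * y)  ≈⟨ *-assoc b a y ⟨
    (b * a) * y  ≈⟨ *-congʳ (trans (*-comm b a) ab≈1) ⟩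
    1# * y       ≈⟨ *-identityˡ y ⟩
    y            ∎

  *-inverse-unique : ∀ {x y z} → x * y ≈ 1# → x * z ≈ 1# → y ≈ z
  *-inverse-unique xy≈1 xz≈1 = *-cancelˡ-invertible xy≈1 (trans xy≈1 (sym xz≈1))

  *-unitˡ : ∀ {a b} x → a * b ≈ 1# → (a * b) * x ≈ x
  *-unitˡ x ab≈1 = trans (*-congʳ ab≈1) (*-identityˡ x)

  -‿*-‿ : ∀ x y → (- x) * (- y) ≈ x * y
  -‿*-‿ x y = trans (sym (-‿distribˡ-* x (- y))) (trans (-‿cong (sym (-‿distribʳ-* x y))) (-‿involutive _))

  -‿distribˡ-*-‿ : ∀ x y → x * y ≈ - ((- x) * y)
  -‿distribˡ-*-‿ x y = trans (sym (-‿involutive _)) (-‿cong (-‿distribˡ-* x y))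

  sum-minus-difference : ∀ f h → (f + h) + - (f - h) ≈ h + h
  sum-minus-difference f h = begin
    (f + h) + - (f - h)     ≈⟨ +-congˡ (-‿+-comm f (- h)) ⟨
    (f + h) + (- f + - - h) ≈⟨ +-congˡ (+-congˡ (-‿involutive h)) ⟩
    (f + h) + (- f + h)     ≈⟨ solve 3 (λ f h f′ → (f :+ h) :+ (f′ :+ h) := (f :+ f′) :+ (h :+ h)) refl f h (- f) ⟩
    (f - f) + (h + h)       ≈⟨ +-congʳ (-‿inverseʳ f) ⟩
    0# + (h + h)            ≈⟨ +-identityˡ _ ⟩
    h + h                   ∎

  difference-minus-sum : ∀ f h → (f - h) + - (f + h) ≈ - (h + h)
  difference-minus-sum f h = begin
    (f - h) + - (f + h)     ≈⟨ +-congˡ (-‿+-comm f h) ⟨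
    (f - h) + (- f + - h)   ≈⟨ solve 3 (λ f h′ f′ → (f :+ h′) :+ (f′ :+ h′) := (f :+ f′) :+ (h′ :+ h′)) refl f (- h) (- f) ⟩
    (f - f) + (- h + - h)   ≈⟨ +-congʳ (-‿inverseʳ f) ⟩
    0# + (- h + - h)        ≈⟨ +-identityˡ _ ⟩
    - h + - h               ≈⟨ -‿+-comm h h ⟩
    - (h + h)               ∎

  -- Summation lemmas at a fixed length, which lets Agda infer the summands.
  module Summation (m : ℕ) where

    ∑-cong : {f g : Fin m → Carrier} → (∀ i → f i ≈ g i) → sum f ≈ sum g
    ∑-cong = sum-cong-≋

    ∑-*ˡ : ∀ x (f : Fin m → Carrier) → x * sum f ≈ ∑[ i < m ] (x * f i)
    ∑-*ˡ = *-distribˡ-sum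

    ∑-*ʳ : ∀ x (f : Fin m → Carrier) → sum f * x ≈ ∑[ i < m ] (f i * x)
    ∑-*ʳ = *-distribʳ-sum

    ∑-+ : (f g : Fin m → Carrier) → ∑[ i < m ] (f i + g i) ≈ sum f + sum g
    ∑-+ = ∑-distrib-+

    ∑-swap : (f : Fin m → Fin m → Carrier) → ∑[ i < m ] ∑[ j < m ] f i j ≈ ∑[ j < m ] ∑[ i < m ] f i j
    ∑-swap = ∑-comm

  ∑-const : ∀ m x → ∑[ i < m ] x ≈ fromℕ m * x
  ∑-const N.zero    x = sym (zeroˡ x)
  ∑-const (N.suc m) x = begin
    x + ∑[ i < m ] x      ≈⟨ +-cong (sym (*-identityˡ x)) (∑-const m x) ⟩
    1# * x + fromℕ m * x  ≈⟨ distribʳ x 1# (fromℕ m) ⟨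
    (1# + fromℕ m) * x    ∎

  ∑-neg : ∀ m (f : Fin m → Carrier) → ∑[ l < m ] (- f l) ≈ - sum f
  ∑-neg N.zero    f = sym -0#≈0#
  ∑-neg (N.suc m) f = trans (+-congˡ (∑-neg m (λ l → f (suc l)))) (-‿+-comm _ _)

  I-diag : ∀ {m} (i : Fin m) → I i i ≈ 1#
  I-diag i with i F.≟ i
  ... | yes _  = refl
  ... | no i≢i = ⊥-elim (i≢i ≡.refl)

  I-off : ∀ {m} {i j : Fin m} → i ≢ j → I i j ≈ 0#
  I-off {i = i} {j} i≢j with i F.≟ j
  ... | yes i≡j = ⊥-elim (i≢j i≡j)
  ... | no _    = refl

  I-sym : ∀ {m} (i j : Fin m) → I i j ≈ I j i
  I-sym i j with i F.≟ j
  ... | yes ≡.refl = sym (I-diag i)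
  ... | no i≢j     = sym (I-off (λ j≡i → i≢j (≡.sym j≡i)))

  I-subst : ∀ {m} (f : Fin m → Carrier) p t → f t * I p t ≈ f p * I p t
  I-subst f p t with p F.≟ t
  ... | yes ≡.refl = refl
  ... | no _       = trans (zeroʳ _) (sym (zeroʳ _))

  ∑-δʳ : ∀ {m} (f : Fin m → Carrier) k → ∑[ j < m ] (f j * I j k) ≈ f k
  ∑-δʳ {N.suc m} f k = begin
    ∑[ j < N.suc m ] (f j * I j k)
      ≈⟨ sum-remove {i = k} (λ j → f j * I j k) ⟩
    f k * I k k + ∑[ j < m ] (f (punchIn k j) * I (punchIn k j) k)
      ≈⟨ +-cong (*-congˡ (I-diag k)) (Summation.∑-cong m λ j → trans (*-congˡ (I-off (FinP.punchInᵢ≢i k j))) (zeroʳ _)) ⟩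
    f k * 1# + ∑[ j < m ] 0#
      ≈⟨ +-cong (*-identityʳ (f k)) (sum-replicate-zero m) ⟩
    f k + 0#
      ≈⟨ +-identityʳ (f k) ⟩
    f k ∎

  ∑-δˡ : ∀ {m} (f : Fin m → Carrier) k → ∑[ j < m ] (I k j * f j) ≈ f k
  ∑-δˡ {m} f k = trans (Summation.∑-cong m λ j → trans (*-comm _ _) (*-congˡ (I-sym k j))) (∑-δʳ f k)

  ∑-++ : ∀ m k (f : Fin (m N.+ k) → Carrier) → sum f ≈ ∑[ i < m ] f (i ↑ˡ k) + ∑[ j < k ] f (m ↑ʳ j)
  ∑-++ N.zero    k f = sym (+-identityˡ _)
  ∑-++ (N.suc m) k f = trans (+-congˡ (∑-++ m k (λ i → f (suc i)))) (sym (+-assoc _ _ _))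

  ∑-combine : ∀ m k (f : Fin (m N.* k) → Carrier) → sum f ≈ ∑[ b < m ] ∑[ i < k ] f (combine b i)
  ∑-combine N.zero    k f = refl
  ∑-combine (N.suc m) k f = trans (∑-++ k (m N.* k) f) (+-congˡ (∑-combine m k (λ j → f (k ↑ʳ j))))

  ·-congˡ : ∀ {m k n} {X X′ : Mat m k} (Y : Mat k n) → X ≈ᴹ X′ → (X · Y) ≈ᴹ (X′ · Y)
  ·-congˡ {k = k} Y X≈X′ p t = Summation.∑-cong k λ u → *-congʳ (X≈X′ p u)

  ·-congʳ : ∀ {m k n} (X : Mat m k) {Y Y′ : Mat k n} → Y ≈ᴹ Y′ → (X · Y) ≈ᴹ (X · Y′)
  ·-congʳ {k = k} X Y≈Y′ p t = Summation.∑-cong k λ u → *-congˡ (Y≈Y′ u t)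

  ·-assoc : ∀ {m k l n} (X : Mat m k) (Y : Mat k l) (Z : Mat l n) → ((X · Y) · Z) ≈ᴹ (X · (Y · Z))
  ·-assoc {k = k} {l} X Y Z p t = begin
    ∑[ r < l ] (∑[ u < k ] (X p u * Y u r) * Z r t)  ≈⟨ L.∑-cong (λ r → K.∑-*ʳ (Z r t) _) ⟩
    ∑[ r < l ] ∑[ u < k ] (X p u * Y u r * Z r t)    ≈⟨ ∑-comm {l} {k} _ ⟩
    ∑[ u < k ] ∑[ r < l ] (X p u * Y u r * Z r t)    ≈⟨ K.∑-cong (λ u → L.∑-cong λ r → *-assoc _ _ _) ⟩
    ∑[ u < k ] ∑[ r < l ] (X p u * (Y u r * Z r t))  ≈⟨ K.∑-cong (λ u → L.∑-*ˡ (X p u) _) ⟨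
    ∑[ u < k ] (X p u * ∑[ r < l ] (Y u r * Z r t))  ∎
    where module K = Summation k
          module L = Summation l

  ᵀ-· : ∀ {m k n} (X : Mat m k) (Y : Mat k n) → (X · Y) ᵀ ≈ᴹ Y ᵀ · X ᵀ
  ᵀ-· {k = k} X Y p t = Summation.∑-cong k λ u → *-comm (X t u) (Y u p)

  ᵀ-·-· : ∀ {m k l n} (X : Mat m k) (Y : Mat k l) (Z : Mat l n) →
          (X · (Y · Z)) ᵀ ≈ᴹ Z ᵀ · (Y ᵀ · X ᵀ)
  ᵀ-·-· X Y Z p t = begin
    ((X · (Y · Z)) ᵀ) p t      ≈⟨ ᵀ-· X (Y · Z) p t ⟩
    ((Y · Z) ᵀ · X ᵀ) p t      ≈⟨ ·-congˡ (X ᵀ) (ᵀ-· Y Z) p t ⟩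
    (Z ᵀ · Y ᵀ · X ᵀ) p t      ≈⟨ ·-assoc (Z ᵀ) (Y ᵀ) (X ᵀ) p t ⟩
    (Z ᵀ · (Y ᵀ · X ᵀ)) p t    ∎

  ·-identityʳ : ∀ {m n} (X : Mat m n) → (X · I) ≈ᴹ X
  ·-identityʳ X p = ∑-δʳ (X p)

  ·-scaledIdentityʳ : ∀ {m n} (X : Mat m n) a → (X · (a ∙ᴹ I)) ≈ᴹ (a ∙ᴹ X)
  ·-scaledIdentityʳ {n = n} X a p t = begin
    ∑[ u < n ] (X p u * (a * I u t))  ≈⟨ Summation.∑-cong n (λ u → solve 3 (λ x a δ → x :* (a :* δ) := (a :* x) :* δ) refl (X p u) a (I u t)) ⟩
    ∑[ u < n ] ((a * X p u) * I u t)  ≈⟨ ∑-δʳ (λ u → a * X p u) t ⟩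
    a * X p t                         ∎

  ·-scaledIdentityˡ : ∀ {m n} a (X : Mat m n) → ((a ∙ᴹ I) · X) ≈ᴹ (a ∙ᴹ X)
  ·-scaledIdentityˡ {m} a X p t = begin
    ∑[ u < m ] ((a * I p u) * X u t)  ≈⟨ Summation.∑-cong m (λ u → solve 3 (λ a δ x → (a :* δ) :* x := δ :* (a :* x)) refl a (I p u) (X u t)) ⟩
    ∑[ u < m ] (I p u * (a * X u t))  ≈⟨ ∑-δˡ (λ u → a * X u t) p ⟩
    a * X p t                         ∎

  ·-∙ᴹʳ : ∀ {m k n} (X : Mat m k) a (Y : Mat k n) → (X · (a ∙ᴹ Y)) ≈ᴹ (a ∙ᴹ (X · Y))
  ·-∙ᴹʳ {k = k} X a Y p t = begin
    ∑[ u < k ] (X p u * (a * Y u t))  ≈⟨ ∑-cong (λ u → solve 3 (λ x a y → x :* (a :* y) := a :* (x :* y)) refl (X p u) a (Y u t)) ⟩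
    ∑[ u < k ] (a * (X p u * Y u t))  ≈⟨ ∑-*ˡ a _ ⟨
    a * (X · Y) p t                   ∎
    where open Summation k

  left≈right-inverse : ∀ {n} {X Y Z : Mat n n} {a b} → a * b ≈ 1# →
                       (Y · X) ≈ᴹ (a ∙ᴹ I) → (X · Z) ≈ᴹ (a ∙ᴹ I) → Y ≈ᴹ Z
  left≈right-inverse {X = X} {Y} {Z} {a} ab≈1 YX≈a XZ≈a p t = *-cancelˡ-invertible ab≈1 (begin
    a * Y p t              ≈⟨ ·-scaledIdentityʳ Y a p t ⟨
    (Y · (a ∙ᴹ I)) p t     ≈⟨ ·-congʳ Y XZ≈a p t ⟨
    (Y · (X · Z)) p t      ≈⟨ ·-assoc Y X Z p t ⟨
    ((Y · X) · Z) p t      ≈⟨ ·-congˡ Z YX≈a p t ⟩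
    ((a ∙ᴹ I) · Z) p t     ≈⟨ ·-scaledIdentityˡ a Z p t ⟩
    a * Z p t              ∎)

  *ᵥ-congˡ : ∀ {m n} {X X′ : Mat m n} (w : Vect n) → X ≈ᴹ X′ → (X *ᵥ w) ≈ᵛ (X′ *ᵥ w)
  *ᵥ-congˡ {n = n} w X≈X′ i = Summation.∑-cong n λ l → *-congʳ (X≈X′ i l)

  ·-*ᵥ : ∀ {m k n} (X : Mat m k) (Y : Mat k n) (w : Vect n) → ((X · Y) *ᵥ w) ≈ᵛ (X *ᵥ (Y *ᵥ w))
  ·-*ᵥ {k = k} {n} X Y w i = begin
    ∑[ l < n ] (∑[ u < k ] (X i u * Y u l) * w l)  ≈⟨ L.∑-cong (λ l → K.∑-*ʳ (w l) _) ⟩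
    ∑[ l < n ] ∑[ u < k ] (X i u * Y u l * w l)    ≈⟨ ∑-comm {n} {k} _ ⟩
    ∑[ u < k ] ∑[ l < n ] (X i u * Y u l * w l)    ≈⟨ K.∑-cong (λ u → L.∑-cong λ l → *-assoc _ _ _) ⟩
    ∑[ u < k ] ∑[ l < n ] (X i u * (Y u l * w l))  ≈⟨ K.∑-cong (λ u → L.∑-*ˡ (X i u) _) ⟨
    ∑[ u < k ] (X i u * (Y *ᵥ w) u)                ∎
    where module K = Summation k
          module L = Summation n

  -ᵥ_ : ∀ {m} → Vect m → Vect m
  (-ᵥ v) i = - v i

  +ᴹ-*ᵥ : ∀ {m n} (X Y : Mat m n) (v : Vect n) i → ((X +ᴹ Y) *ᵥ v) i ≈ (X *ᵥ v) i + (Y *ᵥ v) i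
  +ᴹ-*ᵥ {n = n} X Y v i = trans (Summation.∑-cong n λ l → distribʳ (v l) (X i l) (Y i l)) (Summation.∑-+ n _ _)

  *ᵥ-neg : ∀ {m n} (X : Mat m n) (v : Vect n) i → (X *ᵥ (-ᵥ v)) i ≈ - (X *ᵥ v) i
  *ᵥ-neg {n = n} X v i = trans (Summation.∑-cong n λ l → sym (-‿distribʳ-* (X i l) (v l))) (∑-neg n _)

  -ᴹ-*ᵥ : ∀ {m n} (X Y : Mat m n) (v : Vect n) i → ((X -ᴹ Y) *ᵥ v) i ≈ (X *ᵥ v) i - (Y *ᵥ v) i
  -ᴹ-*ᵥ {n = n} X Y v i = begin
    ∑[ l < n ] ((X i l - Y i l) * v l)          ≈⟨ Summation.∑-cong n (λ l → trans (distribʳ (v l) (X i l) (- Y i l)) (+-congˡ (sym (-‿distribˡ-* (Y i l) (v l))))) ⟩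
    ∑[ l < n ] (X i l * v l + - (Y i l * v l))  ≈⟨ Summation.∑-+ n _ _ ⟩
    (X *ᵥ v) i + ∑[ l < n ] (- (Y i l * v l))   ≈⟨ +-congˡ (∑-neg n _) ⟩
    (X *ᵥ v) i - (Y *ᵥ v) i                     ∎

  eigenvector-rescale : ∀ {n} {M : Mat n n} {v x : Vect n} {λ′} a → (∀ k → x k ≈ a * v k) →
                        (M *ᵥ v) ≈ᵛ (λ′ ∙ᵥ v) → (M *ᵥ x) ≈ᵛ (λ′ ∙ᵥ x)
  eigenvector-rescale {n} {M} {v} {x} {λ′} a x≈av Mv≈λv k = begin
    ∑[ l < n ] (M k l * x l)        ≈⟨ ∑-cong (λ l → trans (*-congˡ (x≈av l)) (solve 3 (λ m a v → m :* (a :* v) := a :* (m :* v)) refl (M k l) a (v l))) ⟩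
    ∑[ l < n ] (a * (M k l * v l))  ≈⟨ ∑-*ˡ a _ ⟨
    a * (M *ᵥ v) k                  ≈⟨ *-congˡ (Mv≈λv k) ⟩
    a * (λ′ * v k)                  ≈⟨ solve 3 (λ a l v → a :* (l :* v) := l :* (a :* v)) refl a λ′ (v k) ⟩
    λ′ * (a * v k)                  ≈⟨ *-congˡ (x≈av k) ⟨
    λ′ * x k                        ∎
    where open Summation n

  IsΘ-cong : ∀ {n} {P Q M θ θ′ : Mat n n} → θ ≈ᴹ θ′ → IsΘ P Q M θ → IsΘ P Q M θ′
  IsΘ-cong θ≈θ′ Θ a c p = trans (Θ a c p) (*-congʳ (θ≈θ′ a c))

  Symmetric-schurInverse : ∀ {n} {P P⁻ : Mat n n} → Symmetric P → IsSchurInverse P P⁻ → Symmetric P⁻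
  Symmetric-schurInverse {P = P} {P⁻} symP schur i j = begin
    P⁻ j i                    ≈⟨ *-identityʳ _ ⟨
    P⁻ j i * 1#               ≈⟨ *-congˡ (schur i j) ⟨
    P⁻ j i * (P i j * P⁻ i j) ≈⟨ *-congˡ (*-congʳ (symP i j)) ⟨
    P⁻ j i * (P j i * P⁻ i j) ≈⟨ solve 3 (λ x y z → x :* (y :* z) := (y :* x) :* z) refl (P⁻ j i) (P j i) (P⁻ i j) ⟩
    (P j i * P⁻ j i) * P⁻ i j ≈⟨ *-congʳ (schur j i) ⟩
    1# * P⁻ i j               ≈⟨ *-identityˡ _ ⟩
    P⁻ i j                    ∎

  schurProduct-nonzero : ∀ {m n} {X X⁻ : Mat m n} → ¬ (1# ≈ 0#) → IsSchurInverse X X⁻ → ∀ t r s → ¬ (X t r * X⁻ t s ≈ 0#)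
  schurProduct-nonzero {X = X} {X⁻} 1≉0 schur t r s XX⁻≈0 = 1≉0 (begin
    1#                                    ≈⟨ *-identityˡ 1# ⟨
    1# * 1#                               ≈⟨ *-cong (schur t r) (schur t s) ⟨
    (X t r * X⁻ t r) * (X t s * X⁻ t s)   ≈⟨ solve 4 (λ a b c e → (a :* b) :* (c :* e) := (a :* e) :* (b :* c)) refl (X t r) (X⁻ t r) (X t s) (X⁻ t s) ⟩
    (X t r * X⁻ t s) * (X⁻ t r * X t s)   ≈⟨ *-congʳ XX⁻≈0 ⟩
    0# * (X⁻ t r * X t s)                 ≈⟨ zeroˡ _ ⟩
    0#                                    ∎)

  -- Type-II matrices

  record IsTypeII {n} (P P⁻ : Mat n n) : Set ℓ where
    field
      schur : IsSchurInverse P P⁻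
      rows  : (P · P⁻ ᵀ) ≈ᴹ (fromℕ n ∙ᴹ I)
      cols  : (P ᵀ · P⁻) ≈ᴹ (fromℕ n ∙ᴹ I)

  typeII-swap : ∀ {n} {P P⁻ : Mat n n} → IsTypeII P P⁻ → IsTypeII P⁻ P
  typeII-swap {n} W = record
    { schur = λ i j → trans (*-comm _ _) (schur i j)
    ; rows  = λ i j → trans (∑-cong λ k → *-comm _ _) (trans (rows j i) (*-congˡ (I-sym j i)))
    ; cols  = λ i j → trans (∑-cong λ k → *-comm _ _) (trans (cols j i) (*-congˡ (I-sym j i)))
    }
    where open IsTypeII W
          open Summation n

  typeII-transpose : ∀ {n} {P P⁻ : Mat n n} → IsTypeII P P⁻ → IsTypeII (P ᵀ) (P⁻ ᵀ)
  typeII-transpose W = record { schur = λ i j → schur j i ; rows = cols ; cols = rows }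
    where open IsTypeII W

  symmetric-typeII-·⁻ : ∀ {n} {P P⁻ : Mat n n} → Symmetric P → IsTypeII P P⁻ → (P · P⁻) ≈ᴹ (fromℕ n ∙ᴹ I)
  symmetric-typeII-·⁻ {n} symP W r t = trans (Summation.∑-cong n λ k → *-congʳ (symP k r)) (IsTypeII.cols W r t)

  symmetric-typeII-⁻· : ∀ {n} {P P⁻ : Mat n n} → Symmetric P → IsTypeII P P⁻ → (P⁻ · P) ≈ᴹ (fromℕ n ∙ᴹ I)
  symmetric-typeII-⁻· {n} symP W r t =
    trans (Summation.∑-cong n λ k → trans (*-comm _ _) (*-congʳ (symP t k))) (trans (IsTypeII.rows W t r) (*-congˡ (I-sym t r)))

  rankOne-unitSums⇒constant : ∀ {n} (W : Mat n n) (u v : Fin n → Carrier) → (∀ p k → W p k ≈ u p * v k) →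
    (∀ p → ∑[ k < n ] W p k ≈ 1#) → (∀ k → ∑[ p < n ] W p k ≈ 1#) → ∀ p k → fromℕ n * W p k ≈ 1#
  rankOne-unitSums⇒constant {n} W u v W≈uv rowSum colSum p k = begin
    fromℕ n * W p k            ≈⟨ *-cong (sym ∑u*∑v≈n) (W≈uv p k) ⟩
    (∑u * ∑v) * (u p * v k)    ≈⟨ solve 4 (λ x y z w → (x :* y) :* (z :* w) := (z :* y) :* (w :* x)) refl ∑u ∑v (u p) (v k) ⟩
    (u p * ∑v) * (v k * ∑u)    ≈⟨ *-cong (u*∑v≈1 p) (v*∑u≈1 k) ⟩
    1# * 1#                    ≈⟨ *-identityˡ 1# ⟩
    1#                         ∎
    where
    open Summation n
    ∑u = ∑[ p < n ] u p
    ∑v = ∑[ k < n ] v k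
    u*∑v≈1 : ∀ p → u p * ∑v ≈ 1#
    u*∑v≈1 p = trans (∑-*ˡ (u p) v) (trans (∑-cong λ k → sym (W≈uv p k)) (rowSum p))
    v*∑u≈1 : ∀ k → v k * ∑u ≈ 1#
    v*∑u≈1 k = trans (*-comm _ _) (trans (∑-*ʳ (v k) u) (trans (∑-cong λ p → sym (W≈uv p k)) (colSum k)))
    ∑u*∑v≈n : ∑u * ∑v ≈ fromℕ n
    ∑u*∑v≈n = trans (∑-*ʳ ∑v u) (trans (∑-cong u*∑v≈1) (trans (∑-const n 1#) (*-identityʳ _)))

  constantProduct⇒rankOne : ∀ {n} {W Y Y′ : Mat n n} (f : Fin n → Carrier) → (∀ p c → (W · Y) p c ≈ f p) →
    (Y · Y′) ≈ᴹ I → ∀ p k → W p k ≈ f p * ∑[ c < n ] Y′ c k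
  constantProduct⇒rankOne {n} {W} {Y} {Y′} f WY≈f YY′≈I p k = begin
    W p k                           ≈⟨ ·-identityʳ W p k ⟨
    (W · I) p k                     ≈⟨ ·-congʳ W YY′≈I p k ⟨
    (W · (Y · Y′)) p k              ≈⟨ ·-assoc W Y Y′ p k ⟨
    ∑[ c < n ] ((W · Y) p c * Y′ c k)  ≈⟨ ∑-cong (λ c → *-congʳ (WY≈f p c)) ⟩
    ∑[ c < n ] (f p * Y′ c k)       ≈⟨ ∑-*ˡ (f p) (λ c → Y′ c k) ⟨
    f p * ∑[ c < n ] Y′ c k         ∎
    where open Summation n

  typeII-of-rankOne : ∀ {n} {P P′ P⁻ : Mat n n} (u v : Fin n → Carrier) → (P · P′) ≈ᴹ I → (P′ · P) ≈ᴹ I →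
    IsSchurInverse P P⁻ → (∀ p k → P p k * P′ k p ≈ u p * v k) → IsTypeII P P⁻
  typeII-of-rankOne {n} {P} {P′} {P⁻} u v PP′≈I P′P≈I schur rankOne = record
    { schur = schur
    ; rows  = λ r t → begin
        ∑[ k < n ] (P r k * P⁻ t k)            ≈⟨ ∑-cong (λ k → *-congˡ (P⁻≈νP′ᵀ t k)) ⟩
        ∑[ k < n ] (P r k * (fromℕ n * P′ k t))  ≈⟨ ∑-cong (λ k → x*[y*z]≈y*[x*z] _ _ _) ⟩
        ∑[ k < n ] (fromℕ n * (P r k * P′ k t))  ≈⟨ ∑-*ˡ (fromℕ n) _ ⟨
        fromℕ n * (P · P′) r t                  ≈⟨ *-congˡ (PP′≈I r t) ⟩
        fromℕ n * I r t                        ∎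
    ; cols  = λ r t → begin
        ∑[ k < n ] (P k r * P⁻ k t)            ≈⟨ ∑-cong (λ k → *-congˡ (P⁻≈νP′ᵀ k t)) ⟩
        ∑[ k < n ] (P k r * (fromℕ n * P′ t k))  ≈⟨ ∑-cong (λ k → solve 3 (λ x y z → x :* (y :* z) := y :* (z :* x)) refl _ _ _) ⟩
        ∑[ k < n ] (fromℕ n * (P′ t k * P k r))  ≈⟨ ∑-*ˡ (fromℕ n) _ ⟨
        fromℕ n * (P′ · P) t r                  ≈⟨ *-congˡ (trans (P′P≈I t r) (I-sym t r)) ⟩
        fromℕ n * I r t                        ∎
    }
    where
    open Summation n
    x*[y*z]≈y*[x*z] : ∀ x y z → x * (y * z) ≈ y * (x * z)
    x*[y*z]≈y*[x*z] = solve 3 (λ x y z → x :* (y :* z) := y :* (x :* z)) refl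
    νPP′≈1 : ∀ p k → fromℕ n * (P p k * P′ k p) ≈ 1#
    νPP′≈1 = rankOne-unitSums⇒constant (λ p k → P p k * P′ k p) u v rankOne
      (λ p → trans (PP′≈I p p) (I-diag p))
      (λ k → trans (∑-cong λ p → *-comm _ _) (trans (P′P≈I k k) (I-diag k)))
    P⁻≈νP′ᵀ : ∀ p k → P⁻ p k ≈ fromℕ n * P′ k p
    P⁻≈νP′ᵀ p k = begin
      P⁻ p k                                    ≈⟨ *-identityʳ _ ⟨
      P⁻ p k * 1#                               ≈⟨ *-congˡ (νPP′≈1 p k) ⟨
      P⁻ p k * (fromℕ n * (P p k * P′ k p))     ≈⟨ solve 4 (λ x y z w → x :* (y :* (z :* w)) := (z :* x) :* (y :* w)) refl (P⁻ p k) (fromℕ n) (P p k) (P′ k p) ⟩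
      (P p k * P⁻ p k) * (fromℕ n * P′ k p)     ≈⟨ *-congʳ (schur p k) ⟩
      1# * (fromℕ n * P′ k p)                   ≈⟨ *-identityˡ _ ⟩
      fromℕ n * P′ k p                          ∎

  -- Invertible Jones pairs

  braid⇒Θ : ∀ {n} {A C : Mat n n} → (∀ X → (A · (C ⊙ (A · X))) ≈ᴹ (C ⊙ (A · (C ⊙ X)))) → IsΘ A C A C
  braid⇒Θ {n} {A} {C} braid m c p = begin
    ∑[ q < n ] (A p q * (A q m * C q c))
      ≈⟨ ∑-cong (λ q → *-congˡ (trans (*-comm _ _) (*-congˡ (sym (∑-δʳ (A q) m))))) ⟩
    (A · (C ⊙ (A · Eₘ))) p c
      ≈⟨ braid Eₘ p c ⟩
    C p c * ∑[ q < n ] (A p q * (C q c * I q m))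
      ≈⟨ *-congˡ (trans (∑-cong λ q → sym (*-assoc _ _ _)) (∑-δʳ (λ q → A p q * C q c) m)) ⟩
    C p c * (A p m * C m c)
      ≈⟨ solve 3 (λ x y z → x :* (y :* z) := z :* (y :* x)) refl (C p c) (A p m) (C m c) ⟩
    C m c * (A p m * C p c) ∎
    where
    open Summation n
    Eₘ : Mat n n
    Eₘ i _ = I i m

  Θ-braid-rowSums : ∀ {n} {A A′ B B⁻ : Mat n n} → IsΘ A B A B → (A · A′) ≈ᴹ I → IsSchurInverse B B⁻ →
    ∀ p c → ((A ⊙ A′ ᵀ) · B) p c ≈ A p p
  Θ-braid-rowSums {n} {A} {A′} {B} Θ AA′≈I schurB p c = *-cancelˡ-invertible (schurB p c) (begin
    B p c * ∑[ m < n ] ((A p m * A′ m p) * B m c)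
      ≈⟨ ∑-*ˡ (B p c) _ ⟩
    ∑[ m < n ] (B p c * ((A p m * A′ m p) * B m c))
      ≈⟨ ∑-cong (λ m → solve 4 (λ b a a′ b′ → b :* ((a :* a′) :* b′) := (b′ :* (a :* b)) :* a′) refl (B p c) (A p m) (A′ m p) (B m c)) ⟩
    ∑[ m < n ] ((B m c * (A p m * B p c)) * A′ m p)
      ≈⟨ ∑-cong (λ m → *-congʳ (Θ m c p)) ⟨
    ∑[ m < n ] (∑[ q < n ] (A p q * (A q m * B q c)) * A′ m p)
      ≈⟨ ∑-cong (λ m → ∑-*ʳ (A′ m p) _) ⟩
    ∑[ m < n ] ∑[ q < n ] ((A p q * (A q m * B q c)) * A′ m p)
      ≈⟨ ∑-swap _ ⟩
    ∑[ q < n ] ∑[ m < n ] ((A p q * (A q m * B q c)) * A′ m p)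
      ≈⟨ ∑-cong (λ q → ∑-cong λ m → solve 4 (λ a a′ b a″ → (a :* (a′ :* b)) :* a″ := (a :* b) :* (a′ :* a″)) refl (A p q) (A q m) (B q c) (A′ m p)) ⟩
    ∑[ q < n ] ∑[ m < n ] ((A p q * B q c) * (A q m * A′ m p))
      ≈⟨ ∑-cong (λ q → ∑-*ˡ (A p q * B q c) _) ⟨
    ∑[ q < n ] ((A p q * B q c) * (A · A′) q p)
      ≈⟨ ∑-cong (λ q → *-congˡ (AA′≈I q p)) ⟩
    ∑[ q < n ] ((A p q * B q c) * I q p)
      ≈⟨ ∑-δʳ (λ q → A p q * B q c) p ⟩
    A p p * B p c
      ≈⟨ *-comm _ _ ⟩
    B p c * A p p ∎)
    where open Summation n

  Θ-braid-colSums : ∀ {n} {A A⁻ B B′ : Mat n n} → IsΘ A B A B → (B · B′) ≈ᴹ I → IsSchurInverse A A⁻ →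
    ∀ p m → ((B ⊙ B′ ᵀ) · B ᵀ) p m ≈ A p p
  Θ-braid-colSums {n} {A} {A⁻} {B} {B′} Θ BB′≈I schurA p m = *-cancelˡ-invertible (schurA p m) (begin
    A p m * ∑[ c < n ] ((B p c * B′ c p) * B m c)
      ≈⟨ ∑-*ˡ (A p m) _ ⟩
    ∑[ c < n ] (A p m * ((B p c * B′ c p) * B m c))
      ≈⟨ ∑-cong (λ c → solve 4 (λ a b b′ b″ → a :* ((b :* b′) :* b″) := (b″ :* (a :* b)) :* b′) refl (A p m) (B p c) (B′ c p) (B m c)) ⟩
    ∑[ c < n ] ((B m c * (A p m * B p c)) * B′ c p)
      ≈⟨ ∑-cong (λ c → *-congʳ (Θ m c p)) ⟨
    ∑[ c < n ] (∑[ q < n ] (A p q * (A q m * B q c)) * B′ c p)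
      ≈⟨ ∑-cong (λ c → ∑-*ʳ (B′ c p) _) ⟩
    ∑[ c < n ] ∑[ q < n ] ((A p q * (A q m * B q c)) * B′ c p)
      ≈⟨ ∑-swap _ ⟩
    ∑[ q < n ] ∑[ c < n ] ((A p q * (A q m * B q c)) * B′ c p)
      ≈⟨ ∑-cong (λ q → ∑-cong λ c → solve 4 (λ a a′ b b′ → (a :* (a′ :* b)) :* b′ := (a :* a′) :* (b :* b′)) refl (A p q) (A q m) (B q c) (B′ c p)) ⟩
    ∑[ q < n ] ∑[ c < n ] ((A p q * A q m) * (B q c * B′ c p))
      ≈⟨ ∑-cong (λ q → ∑-*ˡ (A p q * A q m) _) ⟨
    ∑[ q < n ] ((A p q * A q m) * (B · B′) q p)
      ≈⟨ ∑-cong (λ q → *-congˡ (BB′≈I q p)) ⟩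
    ∑[ q < n ] ((A p q * A q m) * I q p)
      ≈⟨ ∑-δʳ (λ q → A p q * A q m) p ⟩
    A p p * A p m
      ≈⟨ *-comm _ _ ⟩
    A p m * A p p ∎)
    where open Summation n

  braid-divided : ∀ {n} {P P⁻ Q : Mat n n} {κ} → IsSchurInverse P P⁻ → IsΘ P Q P (κ ∙ᴹ Q) →
                  ∀ a p l → κ * (Q a l * Q p l) ≈ P⁻ a p * ∑[ u < n ] (P a u * (P u p * Q u l))
  braid-divided {n} {P} {P⁻} {Q} {κ} P-schur braid a p l = sym (begin
    P⁻ a p * ∑[ u < n ] (P a u * (P u p * Q u l))  ≈⟨ *-congˡ (braid p l a) ⟩
    P⁻ a p * ((κ * Q p l) * (P a p * Q a l))
      ≈⟨ solve 5 (λ x κ y z w → x :* ((κ :* y) :* (z :* w)) := (z :* x) :* (κ :* (w :* y))) refl (P⁻ a p) κ (Q p l) (P a p) (Q a l) ⟩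
    (P a p * P⁻ a p) * (κ * (Q a l * Q p l))       ≈⟨ *-unitˡ _ (P-schur a p) ⟩
    κ * (Q a l * Q p l)                            ∎)

  jonesPair-typeII : ∀ {n} {A B A⁻ B⁻ : Mat n n} → IsInvertibleJonesPair A B →
    IsSchurInverse A A⁻ → IsSchurInverse B B⁻ → IsTypeII A A⁻ × IsTypeII B B⁻
  jonesPair-typeII {n} {A} {B} (((A′ , AA′≈I , A′A≈I) , _ , braid , _) , _ , (B′ , BB′≈I , B′B≈I)) schurA schurB =
      typeII-of-rankOne (λ p → A p p) (λ k → ∑[ c < n ] B′ c k) AA′≈I A′A≈I schurA
        (constantProduct⇒rankOne (λ p → A p p) (Θ-braid-rowSums Θ AA′≈I schurB) BB′≈I)
    , typeII-of-rankOne (λ p → A p p) (λ k → ∑[ c < n ] B′ k c) BB′≈I B′B≈I schurB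
        (constantProduct⇒rankOne (λ p → A p p) (Θ-braid-colSums Θ BB′≈I schurA) BᵀB′ᵀ≈I)
    where
    Θ = braid⇒Θ braid
    BᵀB′ᵀ≈I : (B ᵀ · B′ ᵀ) ≈ᴹ I
    BᵀB′ᵀ≈I i j = trans (sym (ᵀ-· B′ B i j)) (trans (B′B≈I j i) (I-sym j i))

  -- Block matrices

  blocks-combine : ∀ {n} (Bs : Vec (Vec (Mat n n) 4) 4) b k b′ k′ →
                   blocks Bs (combine b k) (combine b′ k′) ≡ lookup (lookup Bs b) b′ k k′
  blocks-combine {n} Bs b k b′ k′ = ≡.trans (blocks-remQuot (combine b k) (combine b′ k′))
    (≡.cong₂ (λ x y → lookup (lookup Bs (proj₁ x)) (proj₁ y) (proj₂ x) (proj₂ y))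
             (FinP.remQuot-combine {4} {n} b k) (FinP.remQuot-combine {4} {n} b′ k′))
    where
    blocks-remQuot : ∀ r s → blocks Bs r s ≡ lookup (lookup Bs (proj₁ (F.remQuot {4} n r))) (proj₁ (F.remQuot {4} n s))
                                                    (proj₂ (F.remQuot {4} n r)) (proj₂ (F.remQuot {4} n s))
    blocks-remQuot r s with F.remQuot {4} n r | F.remQuot {4} n s
    ... | _ | _ = ≡.refl

  -- w = (v₀, v₁, v₂, v₃) in the block decomposition of Fin (4 * n) used by blocks.
  Stacks : ∀ {n} → Vect (4 N.* n) → Vec (Vect n) 4 → Set ℓ
  Stacks w vs = ∀ b k → w (combine b k) ≈ lookup vs b k

  blocks-*ᵥ : ∀ {n} (Ms : Vec (Vec (Mat n n) 4) 4) {w vs} → Stacks {n} w vs → ∀ b k →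
              (blocks Ms *ᵥ w) (combine b k) ≈ ∑[ b′ < 4 ] (lookup (lookup Ms b) b′ *ᵥ lookup vs b′) k
  blocks-*ᵥ {n} Ms w≈vs b k = trans (∑-combine 4 n _)
    (Summation.∑-cong 4 λ b′ → Summation.∑-cong n λ k′ → *-cong (reflexive (blocks-combine Ms b k b′ k′)) (w≈vs b′ k′))

  +ᴹ-pair : ∀ {m n} (X Y : Mat m n) (v : Vect n) i r →
            ((X +ᴹ Y) *ᵥ v) i + (((X -ᴹ Y) *ᵥ (-ᵥ v)) i + r) ≈ ((Y *ᵥ v) i + (Y *ᵥ v) i) + r
  +ᴹ-pair X Y v i r = begin
    ((X +ᴹ Y) *ᵥ v) i + (((X -ᴹ Y) *ᵥ (-ᵥ v)) i + r)
      ≈⟨ +-cong (+ᴹ-*ᵥ X Y v i) (+-congʳ (trans (*ᵥ-neg (X -ᴹ Y) v i) (-‿cong (-ᴹ-*ᵥ X Y v i)))) ⟩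
    ((X *ᵥ v) i + (Y *ᵥ v) i) + (- ((X *ᵥ v) i - (Y *ᵥ v) i) + r)
      ≈⟨ +-assoc _ _ r ⟨
    (((X *ᵥ v) i + (Y *ᵥ v) i) + - ((X *ᵥ v) i - (Y *ᵥ v) i)) + r
      ≈⟨ +-congʳ (sum-minus-difference _ _) ⟩
    ((Y *ᵥ v) i + (Y *ᵥ v) i) + r ∎

  -ᴹ-pair : ∀ {m n} (X Y : Mat m n) (v : Vect n) i r →
            ((X -ᴹ Y) *ᵥ v) i + (((X +ᴹ Y) *ᵥ (-ᵥ v)) i + r) ≈ - ((Y *ᵥ v) i + (Y *ᵥ v) i) + r
  -ᴹ-pair X Y v i r = begin
    ((X -ᴹ Y) *ᵥ v) i + (((X +ᴹ Y) *ᵥ (-ᵥ v)) i + r)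
      ≈⟨ +-cong (-ᴹ-*ᵥ X Y v i) (+-congʳ (trans (*ᵥ-neg (X +ᴹ Y) v i) (-‿cong (+ᴹ-*ᵥ X Y v i)))) ⟩
    ((X *ᵥ v) i - (Y *ᵥ v) i) + (- ((X *ᵥ v) i + (Y *ᵥ v) i) + r)
      ≈⟨ +-assoc _ _ r ⟨
    (((X *ᵥ v) i - (Y *ᵥ v) i) + - ((X *ᵥ v) i + (Y *ᵥ v) i)) + r
      ≈⟨ +-congʳ (difference-minus-sum _ _) ⟩
    - ((Y *ᵥ v) i + (Y *ᵥ v) i) + r ∎

  neg-pair : ∀ {m n} (X : Mat m n) (v : Vect n) i r → (X *ᵥ v) i + ((X *ᵥ (-ᵥ v)) i + r) ≈ r
  neg-pair X v i r = begin
    (X *ᵥ v) i + ((X *ᵥ (-ᵥ v)) i + r)  ≈⟨ +-congˡ (+-congʳ (*ᵥ-neg X v i)) ⟩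
    (X *ᵥ v) i + (- (X *ᵥ v) i + r)     ≈⟨ +-assoc _ _ r ⟨
    ((X *ᵥ v) i - (X *ᵥ v) i) + r       ≈⟨ +-congʳ (-‿inverseʳ _) ⟩
    0# + r                              ≈⟨ +-identityˡ r ⟩
    r                                   ∎

  Mmat-eigenvector : ∀ {n} (ΘAF ΘBF ΘG ΘGt H K : Mat n n) {w : Vect (4 N.* n)} {x y : Vect n} {λ′} →
    Stacks w (x ∷ -ᵥ x ∷ y ∷ -ᵥ y ∷ []) → (H *ᵥ x) ≈ᵛ (λ′ ∙ᵥ x) → (K *ᵥ y) ≈ᵛ (λ′ ∙ᵥ y) →
    (Mmat ΘAF ΘBF ΘG ΘGt H K *ᵥ w) ≈ᵛ ((λ′ + λ′) ∙ᵥ w)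
  Mmat-eigenvector {n} ΘAF ΘBF ΘG ΘGt H K {w} {x} {y} {λ′} w≈ Hx≈λx Ky≈λy t with FinP.combine-surjective {4} {n} t
  ... | b , k , ≡.refl = trans (blocks-*ᵥ Ms {vs = x ∷ -ᵥ x ∷ y ∷ -ᵥ y ∷ []} w≈ b k) (trans (row b) (*-congˡ (sym (w≈ b k))))
    where
    -- the block list of Mmat, spelled out (Agda cannot infer it from blocks Ms)
    Ms : Vec (Vec (Mat n n) 4) 4
    Ms = ((ΘAF +ᴹ H) ∷ (ΘAF -ᴹ H) ∷ ΘG ∷ ΘG ∷ [])
       ∷ ((ΘAF -ᴹ H) ∷ (ΘAF +ᴹ H) ∷ ΘG ∷ ΘG ∷ [])
       ∷ ((ΘGt ᵀ) ∷ (ΘGt ᵀ) ∷ (ΘBF +ᴹ K) ∷ (ΘBF -ᴹ K) ∷ [])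
       ∷ ((ΘGt ᵀ) ∷ (ΘGt ᵀ) ∷ (ΘBF -ᴹ K) ∷ (ΘBF +ᴹ K) ∷ [])
       ∷ []
    double : ∀ {v : Vect _} {M} → (M *ᵥ v) ≈ᵛ (λ′ ∙ᵥ v) → ((M *ᵥ v) k + (M *ᵥ v) k) + 0# ≈ (λ′ + λ′) * v k
    double Mv≈λv = trans (+-identityʳ _) (trans (+-cong (Mv≈λv k) (Mv≈λv k)) (sym (distribʳ _ λ′ λ′)))
    double-neg : ∀ {v : Vect _} {M} → (M *ᵥ v) ≈ᵛ (λ′ ∙ᵥ v) → - ((M *ᵥ v) k + (M *ᵥ v) k) + 0# ≈ (λ′ + λ′) * - v k
    double-neg Mv≈λv = trans (+-congʳ (-‿cong (trans (+-cong (Mv≈λv k) (Mv≈λv k)) (sym (distribʳ _ λ′ λ′))))) (trans (+-identityʳ _) (-‿distribʳ-* _ _))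
    row : ∀ b → ∑[ b′ < 4 ] (lookup (lookup Ms b) b′ *ᵥ lookup (x ∷ -ᵥ x ∷ y ∷ -ᵥ y ∷ []) b′) k
              ≈ (λ′ + λ′) * lookup (x ∷ -ᵥ x ∷ y ∷ -ᵥ y ∷ []) b k
    row 0F                   = trans (+ᴹ-pair ΘAF H x k _) (trans (+-congˡ (neg-pair ΘG y k 0#)) (double Hx≈λx))
    row 1F             = trans (-ᴹ-pair ΘAF H x k _) (trans (+-congˡ (neg-pair ΘG y k 0#)) (double-neg Hx≈λx))
    row 2F       = trans (neg-pair (ΘGt ᵀ) x k _) (trans (+ᴹ-pair ΘBF K y k 0#) (double Ky≈λy))
    row 3F = trans (neg-pair (ΘGt ᵀ) x k _) (trans (-ᴹ-pair ΘBF K y k 0#) (double-neg Ky≈λy))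

  schurInverse-stacks : ∀ {n} {X X⁻ : Mat (4 N.* n) (4 N.* n)} {vs us : Vec (Vect n) 4} s → IsSchurInverse X X⁻ →
    Stacks (col X s) vs → (∀ b k → lookup vs b k * lookup us b k ≈ 1#) → Stacks (col X⁻ s) us
  schurInverse-stacks {X = X} {X⁻} s schur X≈vs vs*us≈1 b k =
    *-inverse-unique (trans (*-congʳ (sym (X≈vs b k))) (schur (combine b k) s)) (vs*us≈1 b k)

  ⊙-stacks : ∀ {n} {u v : Vect (4 N.* n)} {a b a′ b′ : Vect n} → Stacks u (a ∷ a ∷ b ∷ -ᵥ b ∷ []) →
    Stacks v (a′ ∷ -ᵥ a′ ∷ b′ ∷ b′ ∷ []) → Stacks (u ⊙ᵥ v) (a ⊙ᵥ a′ ∷ -ᵥ (a ⊙ᵥ a′) ∷ b ⊙ᵥ b′ ∷ -ᵥ (b ⊙ᵥ b′) ∷ [])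
  ⊙-stacks u≈ v≈ 0F k                   = *-cong (u≈ 0F k) (v≈ 0F k)
  ⊙-stacks u≈ v≈ 1F k             = trans (*-cong (u≈ 1F k) (v≈ 1F k)) (sym (-‿distribʳ-* _ _))
  ⊙-stacks u≈ v≈ 2F k       = *-cong (u≈ 2F k) (v≈ 2F k)
  ⊙-stacks u≈ v≈ 3F k = trans (*-cong (u≈ 3F k) (v≈ 3F k)) (sym (-‿distribˡ-* _ _))

  module VmatColumns {n} (d : Carrier) (A B⁻ : Mat n n) where

    private
      -- the block list of Vmat, spelled out (Agda cannot infer it from blocks Vs)
      Vs : Vec (Vec (Mat n n) 4) 4
      Vs = ((d ∙ᴹ A) ∷ (-ᴹ (d ∙ᴹ A)) ∷ B⁻ ∷ B⁻ ∷ [])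
         ∷ ((-ᴹ (d ∙ᴹ A)) ∷ (d ∙ᴹ A) ∷ B⁻ ∷ B⁻ ∷ [])
         ∷ ((B⁻ ᵀ) ∷ (B⁻ ᵀ) ∷ (d ∙ᴹ A) ∷ (-ᴹ (d ∙ᴹ A)) ∷ [])
         ∷ ((B⁻ ᵀ) ∷ (B⁻ ᵀ) ∷ (-ᴹ (d ∙ᴹ A)) ∷ (d ∙ᴹ A) ∷ [])
         ∷ []

      V : Mat (4 N.* n) (4 N.* n)
      V = Vmat d A B⁻

      entry : ∀ b k b′ k′ → V (combine b k) (combine b′ k′) ≈ lookup (lookup Vs b) b′ k k′
      entry b k b′ k′ = reflexive (blocks-combine Vs b k b′ k′)

    rightShape : Carrier → Fin n → Vec (Vect n) 4
    rightShape σ i = col B⁻ i ∷ col B⁻ i ∷ σ ∙ᵥ col A i ∷ -ᵥ (σ ∙ᵥ col A i) ∷ []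

    leftShape : Carrier → Fin n → Vec (Vect n) 4
    leftShape τ j = τ ∙ᵥ col A j ∷ -ᵥ (τ ∙ᵥ col A j) ∷ col (B⁻ ᵀ) j ∷ col (B⁻ ᵀ) j ∷ []

    right-column : ∀ (br : Fin 4) i → 2 N.≤ toℕ br → Σ Carrier λ σ → Stacks (col V (combine br i)) (rightShape σ i)
    right-column 0F i ()
    right-column 1F i (N.s≤s ())
    right-column 2F i _ = d , entries
      where
      entries : Stacks (col V (combine {4} 2F i)) (rightShape d i)
      entries 0F k                   = entry 0F k 2F i
      entries 1F k             = entry 1F k 2F i
      entries 2F k       = entry 2F k 2F i
      entries 3F k = entry 3F k 2F i
    right-column 3F i _ = - d , entries
      where
      entries : Stacks (col V (combine {4} 3F i)) (rightShape (- d) i)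
      entries 0F k                   = entry 0F k 3F i
      entries 1F k             = entry 1F k 3F i
      entries 2F k       = trans (entry 2F k 3F i) (-‿distribˡ-* d (A k i))
      entries 3F k = trans (entry 3F k 3F i) (-‿distribˡ-*-‿ d (A k i))

    left-column : ∀ (bs : Fin 4) j → toℕ bs N.< 2 → Σ Carrier λ τ → τ * τ ≈ d * d × Stacks (col V (combine bs j)) (leftShape τ j)
    left-column (suc (suc _)) j (N.s≤s (N.s≤s ()))
    left-column 0F j _ = d , refl , entries
      where
      entries : Stacks (col V (combine {4} 0F j)) (leftShape d j)
      entries 0F k                   = entry 0F k 0F j
      entries 1F k             = entry 1F k 0F j
      entries 2F k       = entry 2F k 0F j
      entries 3F k = entry 3F k 0F j
    left-column 1F j _ = - d , -‿*-‿ d d , entries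
      where
      entries : Stacks (col V (combine {4} 1F j)) (leftShape (- d) j)
      entries 0F k                   = trans (entry 0F k 1F j) (-‿distribˡ-* d (A k j))
      entries 1F k             = trans (entry 1F k 1F j) (-‿distribˡ-*-‿ d (A k j))
      entries 2F k       = entry 2F k 1F j
      entries 3F k = entry 3F k 1F j

  size-invertible : IsFieldR → CharZero → ∀ {n} → Fin n → Σ Carrier λ n⁻¹ → fromℕ n * n⁻¹ ≈ 1#
  size-invertible (_ , inverse) charZero {N.suc n} _ = inverse (fromℕ (N.suc n)) (charZero n)

  module InvertibleSize (n : ℕ) (n⁻¹ : Carrier) (n*n⁻¹≈1 : fromℕ n * n⁻¹ ≈ 1#) where

    open Summation n

    ν : Carrier
    ν = fromℕ n

    ν-cancel : ∀ {x y} → ν * x ≈ ν * y → x ≈ y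
    ν-cancel = *-cancelˡ-invertible n*n⁻¹≈1

    -- For fixed c and D = diag (C e_c), the relation Θ says A D A = D A D (= X below); the claim is
    -- A⁻ D⁻¹ A⁻ = ν D⁻¹ A⁻ D⁻¹, and both sides are inverses of X up to the scalar ν².
    braid-inverse : ∀ {A A⁻ C C⁻ : Mat n n} → Symmetric A → IsTypeII A A⁻ → IsSchurInverse C C⁻ →
                    IsΘ A C A C → IsΘ A⁻ C⁻ A⁻ (ν ∙ᴹ C⁻)
    braid-inverse {A} {A⁻} {C} {C⁻} symA A-typeII schurC Θ m c p = left≈right-inverse νν⁻¹ YX≈ν²I XZ≈ν²I p m
      where
      G H X Y Z : Mat n n
      G q t = A⁻ q t * C⁻ q c
      H q t = A q t * C q c
      X q t = C t c * (A q t * C q c)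
      Y = A⁻ · G
      Z q t = (ν * C⁻ t c) * (A⁻ q t * C⁻ q c)

      νν⁻¹ : (ν * ν) * (n⁻¹ * n⁻¹) ≈ 1#
      νν⁻¹ = trans (solve 4 (λ a b c d → (a :* b) :* (c :* d) := (a :* c) :* (b :* d)) refl ν ν n⁻¹ n⁻¹)
                   (trans (*-cong n*n⁻¹≈1 n*n⁻¹≈1) (*-identityˡ 1#))

      GX≈νA : (G · X) ≈ᴹ (ν ∙ᴹ A)
      GX≈νA q t = begin
        ∑[ u < n ] ((A⁻ q u * C⁻ q c) * X u t)
          ≈⟨ ∑-cong (λ u → *-congˡ (Θ t c u)) ⟨
        ∑[ u < n ] ((A⁻ q u * C⁻ q c) * (A · H) u t)
          ≈⟨ ∑-cong (λ u → solve 3 (λ a c h → (a :* c) :* h := c :* (a :* h)) refl (A⁻ q u) (C⁻ q c) ((A · H) u t)) ⟩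
        ∑[ u < n ] (C⁻ q c * (A⁻ q u * (A · H) u t))
          ≈⟨ ∑-*ˡ (C⁻ q c) _ ⟨
        C⁻ q c * (A⁻ · (A · H)) q t
          ≈⟨ *-congˡ (·-assoc A⁻ A H q t) ⟨
        C⁻ q c * ((A⁻ · A) · H) q t
          ≈⟨ *-congˡ (·-congˡ H (symmetric-typeII-⁻· symA A-typeII) q t) ⟩
        C⁻ q c * ((ν ∙ᴹ I) · H) q t
          ≈⟨ *-congˡ (·-scaledIdentityˡ ν H q t) ⟩
        C⁻ q c * (ν * (A q t * C q c))
          ≈⟨ solve 4 (λ c′ ν a c → c′ :* (ν :* (a :* c)) := (c :* c′) :* (ν :* a)) refl (C⁻ q c) ν (A q t) (C q c) ⟩
        (C q c * C⁻ q c) * (ν * A q t)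
          ≈⟨ trans (*-congʳ (schurC q c)) (*-identityˡ _) ⟩
        ν * A q t ∎

      YX≈ν²I : (Y · X) ≈ᴹ ((ν * ν) ∙ᴹ I)
      YX≈ν²I p t = begin
        ((A⁻ · G) · X) p t       ≈⟨ ·-assoc A⁻ G X p t ⟩
        (A⁻ · (G · X)) p t       ≈⟨ ·-congʳ A⁻ GX≈νA p t ⟩
        (A⁻ · (ν ∙ᴹ A)) p t      ≈⟨ ·-∙ᴹʳ A⁻ ν A p t ⟩
        ν * (A⁻ · A) p t         ≈⟨ *-congˡ (symmetric-typeII-⁻· symA A-typeII p t) ⟩
        ν * (ν * I p t)          ≈⟨ *-assoc ν ν (I p t) ⟨
        (ν * ν) * I p t          ∎

      XZ≈ν²I : (X · Z) ≈ᴹ ((ν * ν) ∙ᴹ I)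
      XZ≈ν²I p t = begin
        ∑[ u < n ] ((C u c * (A p u * C p c)) * ((ν * C⁻ t c) * (A⁻ u t * C⁻ u c)))
          ≈⟨ ∑-cong (λ u → solve 7 (λ cu a cp ν ct′ a′ cu′ → (cu :* (a :* cp)) :* ((ν :* ct′) :* (a′ :* cu′))
                                                        := (ν :* (cp :* ct′)) :* ((cu :* cu′) :* (a :* a′)))
                                     refl (C u c) (A p u) (C p c) ν (C⁻ t c) (A⁻ u t) (C⁻ u c)) ⟩
        ∑[ u < n ] ((ν * (C p c * C⁻ t c)) * ((C u c * C⁻ u c) * (A p u * A⁻ u t)))
          ≈⟨ ∑-cong (λ u → *-congˡ (trans (*-congʳ (schurC u c)) (*-identityˡ _))) ⟩
        ∑[ u < n ] ((ν * (C p c * C⁻ t c)) * (A p u * A⁻ u t))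
          ≈⟨ ∑-*ˡ _ _ ⟨
        (ν * (C p c * C⁻ t c)) * (A · A⁻) p t
          ≈⟨ *-congˡ (symmetric-typeII-·⁻ symA A-typeII p t) ⟩
        (ν * (C p c * C⁻ t c)) * (ν * I p t)
          ≈⟨ solve 3 (λ ν x δ → (ν :* x) :* (ν :* δ) := (ν :* ν) :* (x :* δ)) refl ν (C p c * C⁻ t c) (I p t) ⟩
        (ν * ν) * ((C p c * C⁻ t c) * I p t)
          ≈⟨ *-congˡ (I-subst (λ u → C p c * C⁻ u c) p t) ⟩
        (ν * ν) * ((C p c * C⁻ p c) * I p t)
          ≈⟨ *-congˡ (trans (*-congʳ (schurC p c)) (*-identityˡ _)) ⟩
        (ν * ν) * I p t ∎

    -- For each a: ν M D = D Q diag(θ a ·) Q⁻ᵀ with D = diag (P e_a), i.e. M is diagonalised by the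
    -- basis (P e_a ∘ Q e_c)_c with eigenvalues θ a c (the dual basis being (P⁻ e_a ∘ Q⁻ e_c / ν)_c).
    IsSpectral : (P Q Q⁻ M θ : Mat n n) → Set ℓ
    IsSpectral P Q Q⁻ M θ = ∀ a p r → ν * (M p r * P r a) ≈ P p a * ∑[ c < n ] (θ a c * (Q p c * Q⁻ r c))

    IsΘ⇒spectral : ∀ {P Q Q⁻ M θ : Mat n n} → (Q · Q⁻ ᵀ) ≈ᴹ (ν ∙ᴹ I) → IsΘ P Q M θ → IsSpectral P Q Q⁻ M θ
    IsΘ⇒spectral {P} {Q} {Q⁻} {M} {θ} Q-rows Θ a p r = sym (begin
      P p a * ∑[ c < n ] (θ a c * (Q p c * Q⁻ r c))
        ≈⟨ ∑-*ˡ _ _ ⟩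
      ∑[ c < n ] (P p a * (θ a c * (Q p c * Q⁻ r c)))
        ≈⟨ ∑-cong (λ c → solve 4 (λ x y z w → x :* (y :* (z :* w)) := (y :* (x :* z)) :* w) refl (P p a) (θ a c) (Q p c) (Q⁻ r c)) ⟩
      ∑[ c < n ] ((θ a c * E p c) * Q⁻ r c)
        ≈⟨ ∑-cong (λ c → *-congʳ (Θ a c p)) ⟨
      ((M · E) · Q⁻ ᵀ) p r
        ≈⟨ ·-assoc M E (Q⁻ ᵀ) p r ⟩
      (M · (E · Q⁻ ᵀ)) p r
        ≈⟨ ∑-cong (λ q → *-congˡ (trans (∑-cong λ c → *-assoc _ _ _) (trans (sym (∑-*ˡ (P q a) _)) (*-congˡ (Q-rows q r))))) ⟩
      ∑[ q < n ] (M p q * (P q a * (ν * I q r)))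
        ≈⟨ ∑-cong (λ q → solve 4 (λ m x y z → m :* (x :* (y :* z)) := (y :* (m :* x)) :* z) refl (M p q) (P q a) ν (I q r)) ⟩
      ∑[ q < n ] ((ν * (M p q * P q a)) * I q r)
        ≈⟨ ∑-δʳ (λ q → ν * (M p q * P q a)) r ⟩
      ν * (M p r * P r a) ∎)
      where
      E : Mat n n
      E q c = P q a * Q q c

    spectralᵀ⇒IsΘ : ∀ {P P⁻ Q Q⁻ M φ : Mat n n} → IsSchurInverse P P⁻ → (Q ᵀ · Q⁻) ≈ᴹ (ν ∙ᴹ I) →
                    IsSpectral P Q Q⁻ (M ᵀ) φ → IsΘ P⁻ Q⁻ M φ
    spectralᵀ⇒IsΘ {P} {P⁻} {Q} {Q⁻} {M} {φ} P-schur Q-cols spectral a c p = ν-cancel (begin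
      ν * ∑[ q < n ] (M p q * (P⁻ q a * Q⁻ q c))
        ≈⟨ ∑-*ˡ _ _ ⟩
      ∑[ q < n ] (ν * (M p q * (P⁻ q a * Q⁻ q c)))
        ≈⟨ ∑-cong νM≈ ⟩
      ∑[ q < n ] (P⁻ p a * (S q * Q⁻ q c))
        ≈⟨ ∑-*ˡ _ _ ⟨
      P⁻ p a * ∑[ q < n ] (∑[ k < n ] (φ a k * (Q q k * Q⁻ p k)) * Q⁻ q c)
        ≈⟨ *-congˡ (∑-cong λ q → ∑-*ʳ _ _) ⟩
      P⁻ p a * ∑[ q < n ] ∑[ k < n ] (φ a k * (Q q k * Q⁻ p k) * Q⁻ q c)
        ≈⟨ *-congˡ (∑-swap _) ⟩
      P⁻ p a * ∑[ k < n ] ∑[ q < n ] (φ a k * (Q q k * Q⁻ p k) * Q⁻ q c)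
        ≈⟨ *-congˡ (∑-cong λ k → ∑-cong λ q → solve 4 (λ x y z w → x :* (y :* z) :* w := (x :* z) :* (y :* w)) refl (φ a k) (Q q k) (Q⁻ p k) (Q⁻ q c)) ⟩
      P⁻ p a * ∑[ k < n ] ∑[ q < n ] ((φ a k * Q⁻ p k) * (Q q k * Q⁻ q c))
        ≈⟨ *-congˡ (∑-cong λ k → trans (sym (∑-*ˡ _ _)) (*-congˡ (Q-cols k c))) ⟩
      P⁻ p a * ∑[ k < n ] ((φ a k * Q⁻ p k) * (ν * I k c))
        ≈⟨ *-congˡ (∑-cong λ k → solve 3 (λ x y z → x :* (y :* z) := (y :* x) :* z) refl (φ a k * Q⁻ p k) ν (I k c)) ⟩
      P⁻ p a * ∑[ k < n ] ((ν * (φ a k * Q⁻ p k)) * I k c)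
        ≈⟨ *-congˡ (∑-δʳ (λ k → ν * (φ a k * Q⁻ p k)) c) ⟩
      P⁻ p a * (ν * (φ a c * Q⁻ p c))
        ≈⟨ solve 4 (λ x y z w → x :* (y :* (z :* w)) := y :* (z :* (x :* w))) refl (P⁻ p a) ν (φ a c) (Q⁻ p c) ⟩
      ν * (φ a c * (P⁻ p a * Q⁻ p c)) ∎)
      where
      S : Fin n → Carrier
      S q = ∑[ k < n ] (φ a k * (Q q k * Q⁻ p k))
      νM≈ : ∀ q → ν * (M p q * (P⁻ q a * Q⁻ q c)) ≈ P⁻ p a * (S q * Q⁻ q c)
      νM≈ q = begin
        ν * (M p q * (P⁻ q a * Q⁻ q c))
          ≈⟨ *-unitˡ _ (trans (*-comm _ _) (P-schur p a)) ⟨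
        (P⁻ p a * P p a) * (ν * (M p q * (P⁻ q a * Q⁻ q c)))
          ≈⟨ solve 6 (λ x y ν m z w → (x :* y) :* (ν :* (m :* (z :* w))) := x :* ((ν :* (m :* y)) :* (z :* w))) refl (P⁻ p a) (P p a) ν (M p q) (P⁻ q a) (Q⁻ q c) ⟩
        P⁻ p a * ((ν * (M p q * P p a)) * (P⁻ q a * Q⁻ q c))
          ≈⟨ *-congˡ (*-congʳ (spectral a q p)) ⟩
        P⁻ p a * ((P q a * S q) * (P⁻ q a * Q⁻ q c))
          ≈⟨ *-congˡ (solve 4 (λ x y z w → (x :* y) :* (z :* w) := (x :* z) :* (y :* w)) refl (P q a) (S q) (P⁻ q a) (Q⁻ q c)) ⟩
        P⁻ p a * ((P q a * P⁻ q a) * (S q * Q⁻ q c))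
          ≈⟨ *-congˡ (*-unitˡ _ (P-schur q a)) ⟩
        P⁻ p a * (S q * Q⁻ q c) ∎

    Θ-transpose : ∀ {P P⁻ Q Q⁻ M θ : Mat n n} → IsSchurInverse P P⁻ → IsTypeII Q Q⁻ → IsΘ P Q (M ᵀ) θ → IsΘ P⁻ Q⁻ M θ
    Θ-transpose P-schur Q-typeII Θ = spectralᵀ⇒IsΘ P-schur (IsTypeII.cols Q-typeII) (IsΘ⇒spectral (IsTypeII.rows Q-typeII) Θ)

    -- braid says P Δ P = κ Δ P Δ for Δ = diag (Q e_c), the braid relation of a Jones pair up to the
    -- scalar κ; braid⁻ is the same for the Schur inverses. Jones pairs give κ = 1 and κ⁻ = ν.
    record IsBraidedPair (P P⁻ Q Q⁻ : Mat n n) : Set (c ⊔ ℓ) where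
      field
        P-symmetric : Symmetric P
        P-typeII    : IsTypeII P P⁻
        Q-typeII    : IsTypeII Q Q⁻
        κ κ⁻        : Carrier
        κκ⁻≈ν       : κ * κ⁻ ≈ ν
        braid       : IsΘ P Q P (κ ∙ᴹ Q)
        braid⁻      : IsΘ P⁻ Q⁻ P⁻ (κ⁻ ∙ᴹ Q⁻)

    module _ {P P⁻ Q Q⁻ : Mat n n} (pair : IsBraidedPair P P⁻ Q Q⁻) where

      open IsBraidedPair pair
      open IsTypeII P-typeII using () renaming (schur to P-schur; rows to P-rows)
      open IsTypeII Q-typeII using () renaming (schur to Q-schur; rows to Q-rows)

      P-schurᵀ : ∀ i j → P j i * P⁻ i j ≈ 1#
      P-schurᵀ i j = trans (*-congʳ (P-symmetric i j)) (P-schur i j)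

      star-triangle : ∀ k p r → κ⁻ * ∑[ c < n ] (Q⁻ k c * (Q p c * Q⁻ r c)) ≈ ν * (P k r * (P⁻ k p * P⁻ p r))
      star-triangle k p r = begin
        κ⁻ * ∑[ c < n ] (Q⁻ k c * (Q p c * Q⁻ r c))
          ≈⟨ ∑-*ˡ _ _ ⟩
        ∑[ c < n ] (κ⁻ * (Q⁻ k c * (Q p c * Q⁻ r c)))
          ≈⟨ ∑-cong (λ c → solve 4 (λ κ x y z → κ :* (x :* (y :* z)) := y :* (κ :* (x :* z))) refl κ⁻ (Q⁻ k c) (Q p c) (Q⁻ r c)) ⟩
        ∑[ c < n ] (Q p c * (κ⁻ * (Q⁻ k c * Q⁻ r c)))
          ≈⟨ ∑-cong (λ c → *-congˡ (braid-divided (λ i j → trans (*-comm _ _) (P-schur i j)) braid⁻ k r c)) ⟩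
        ∑[ c < n ] (Q p c * (P k r * ∑[ q < n ] (P⁻ k q * (P⁻ q r * Q⁻ q c))))
          ≈⟨ ∑-cong (λ c → trans (sym (*-assoc _ _ _)) (∑-*ˡ _ _)) ⟩
        ∑[ c < n ] ∑[ q < n ] ((Q p c * P k r) * (P⁻ k q * (P⁻ q r * Q⁻ q c)))
          ≈⟨ ∑-swap _ ⟩
        ∑[ q < n ] ∑[ c < n ] ((Q p c * P k r) * (P⁻ k q * (P⁻ q r * Q⁻ q c)))
          ≈⟨ ∑-cong (λ q → ∑-cong λ c → solve 5 (λ x y z w v → (x :* y) :* (z :* (w :* v)) := (y :* (z :* w)) :* (x :* v)) refl (Q p c) (P k r) (P⁻ k q) (P⁻ q r) (Q⁻ q c)) ⟩
        ∑[ q < n ] ∑[ c < n ] ((P k r * (P⁻ k q * P⁻ q r)) * (Q p c * Q⁻ q c))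
          ≈⟨ ∑-cong (λ q → trans (sym (∑-*ˡ _ _)) (*-congˡ (Q-rows p q))) ⟩
        ∑[ q < n ] ((P k r * (P⁻ k q * P⁻ q r)) * (ν * I p q))
          ≈⟨ ∑-cong (λ q → solve 3 (λ x y z → x :* (y :* z) := z :* (y :* x)) refl (P k r * (P⁻ k q * P⁻ q r)) ν (I p q)) ⟩
        ∑[ q < n ] (I p q * (ν * (P k r * (P⁻ k q * P⁻ q r))))
          ≈⟨ ∑-δˡ (λ q → ν * (P k r * (P⁻ k q * P⁻ q r))) p ⟩
        ν * (P k r * (P⁻ k p * P⁻ p r)) ∎

      module _ {M θ : Mat n n} (spectral : IsSpectral P Q Q⁻ M θ) where

        U : Fin n → Fin n → Fin n → Carrier
        U a p k = ∑[ u < n ] (P a u * (P u p * (M u p * P⁻ u k)))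

        eigenvalue-sum : ∀ a p k → κ * (Q · θ ᵀ) a k ≈ ν * (P⁻ a p * (P p k * U a p k))
        eigenvalue-sum a p k = begin
          κ * ∑[ l < n ] (Q a l * θ k l)
            ≈⟨ ∑-*ˡ _ _ ⟩
          ∑[ l < n ] (κ * (Q a l * θ k l))
            ≈⟨ ∑-cong (λ l → sym (*-unitˡ _ (Q-schur p l))) ⟩
          ∑[ l < n ] ((Q p l * Q⁻ p l) * (κ * (Q a l * θ k l)))
            ≈⟨ ∑-cong (λ l → solve 5 (λ y y′ κ x t → (y :* y′) :* (κ :* (x :* t)) := (t :* y′) :* (κ :* (x :* y))) refl (Q p l) (Q⁻ p l) κ (Q a l) (θ k l)) ⟩
          ∑[ l < n ] ((θ k l * Q⁻ p l) * (κ * (Q a l * Q p l)))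
            ≈⟨ ∑-cong (λ l → *-congˡ (braid-divided P-schur braid a p l)) ⟩
          ∑[ l < n ] ((θ k l * Q⁻ p l) * (P⁻ a p * ∑[ u < n ] (P a u * (P u p * Q u l))))
            ≈⟨ ∑-cong (λ l → trans (sym (*-assoc _ _ _)) (∑-*ˡ _ _)) ⟩
          ∑[ l < n ] ∑[ u < n ] (((θ k l * Q⁻ p l) * P⁻ a p) * (P a u * (P u p * Q u l)))
            ≈⟨ ∑-swap _ ⟩
          ∑[ u < n ] ∑[ l < n ] (((θ k l * Q⁻ p l) * P⁻ a p) * (P a u * (P u p * Q u l)))
            ≈⟨ ∑-cong (λ u → ∑-cong λ l → solve 6 (λ t y x z w v → ((t :* y) :* x) :* (z :* (w :* v))
                := (x :* (z :* w)) :* (t :* (v :* y)))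
                refl (θ k l) (Q⁻ p l) (P⁻ a p) (P a u) (P u p) (Q u l)) ⟩
          ∑[ u < n ] ∑[ l < n ] ((P⁻ a p * (P a u * P u p)) * (θ k l * (Q u l * Q⁻ p l)))
            ≈⟨ ∑-cong (λ u → trans (sym (∑-*ˡ _ _)) (*-congˡ (eigenvalues u))) ⟩
          ∑[ u < n ] ((P⁻ a p * (P a u * P u p)) * (P⁻ u k * (ν * (M u p * P p k))))
            ≈⟨ ∑-cong (λ u → solve 7 (λ x y z w ν m v → (x :* (y :* z)) :* (w :* (ν :* (m :* v)))
                := (ν :* (x :* v)) :* (y :* (z :* (m :* w))))
                refl (P⁻ a p) (P a u) (P u p) (P⁻ u k) ν (M u p) (P p k)) ⟩
          ∑[ u < n ] ((ν * (P⁻ a p * P p k)) * (P a u * (P u p * (M u p * P⁻ u k))))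
            ≈⟨ ∑-*ˡ _ _ ⟨
          (ν * (P⁻ a p * P p k)) * U a p k
            ≈⟨ solve 4 (λ ν x y u → (ν :* (x :* y)) :* u := ν :* (x :* (y :* u))) refl ν (P⁻ a p) (P p k) (U a p k) ⟩
          ν * (P⁻ a p * (P p k * U a p k)) ∎
          where
          eigenvalues : ∀ u → ∑[ l < n ] (θ k l * (Q u l * Q⁻ p l)) ≈ P⁻ u k * (ν * (M u p * P p k))
          eigenvalues u = sym (begin
            P⁻ u k * (ν * (M u p * P p k))                 ≈⟨ *-congˡ (spectral k u p) ⟩
            P⁻ u k * (P u k * ∑[ l < n ] (θ k l * (Q u l * Q⁻ p l)))  ≈⟨ *-assoc _ _ _ ⟨
            (P⁻ u k * P u k) * ∑[ l < n ] (θ k l * (Q u l * Q⁻ p l))  ≈⟨ *-unitˡ _ (trans (*-comm _ _) (P-schur u k)) ⟩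
            ∑[ l < n ] (θ k l * (Q u l * Q⁻ p l))          ∎)

        U-sum : ∀ a p r → ∑[ k < n ] (P k r * U a p k) ≈ ν * (P a r * (P r p * M r p))
        U-sum a p r = begin
          ∑[ k < n ] (P k r * U a p k)
            ≈⟨ ∑-cong (λ k → ∑-*ˡ _ _) ⟩
          ∑[ k < n ] ∑[ u < n ] (P k r * (P a u * (P u p * (M u p * P⁻ u k))))
            ≈⟨ ∑-swap _ ⟩
          ∑[ u < n ] ∑[ k < n ] (P k r * (P a u * (P u p * (M u p * P⁻ u k))))
            ≈⟨ ∑-cong (λ u → ∑-cong λ k → trans (*-congʳ (P-symmetric r k)) (solve 5 (λ x y z w v → x :* (y :* (z :* (w :* v)))
                := (y :* (z :* w)) :* (x :* v))
                refl (P r k) (P a u) (P u p) (M u p) (P⁻ u k))) ⟩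
          ∑[ u < n ] ∑[ k < n ] ((P a u * (P u p * M u p)) * (P r k * P⁻ u k))
            ≈⟨ ∑-cong (λ u → trans (sym (∑-*ˡ _ _)) (*-congˡ (P-rows r u))) ⟩
          ∑[ u < n ] ((P a u * (P u p * M u p)) * (ν * I r u))
            ≈⟨ ∑-cong (λ u → solve 3 (λ x y z → x :* (y :* z) := z :* (y :* x)) refl (P a u * (P u p * M u p)) ν (I r u)) ⟩
          ∑[ u < n ] (I r u * (ν * (P a u * (P u p * M u p))))
            ≈⟨ ∑-δˡ (λ u → ν * (P a u * (P u p * M u p))) r ⟩
          ν * (P a r * (P r p * M r p)) ∎

        spectral-transpose : IsSpectral P Q Q⁻ (M ᵀ) (n⁻¹ ∙ᴹ (Q · (θ ᵀ · Q⁻)))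
        spectral-transpose a p r = sym (ν-cancel (begin
          ν * (P p a * ∑[ c < n ] ((n⁻¹ * (Q · (θ ᵀ · Q⁻)) a c) * W c))
            ≈⟨ *-congˡ (*-congˡ reorder) ⟩
          ν * (P p a * (n⁻¹ * ∑[ k < n ] (X k * Y k)))
            ≈⟨ *-congʳ κκ⁻≈ν ⟨
          (κ * κ⁻) * (P p a * (n⁻¹ * ∑[ k < n ] (X k * Y k)))
            ≈⟨ solve 4 (λ κκ x y s → κκ :* (x :* (y :* s)) := x :* (y :* (κκ :* s))) refl (κ * κ⁻) (P p a) n⁻¹ _ ⟩
          P p a * (n⁻¹ * ((κ * κ⁻) * ∑[ k < n ] (X k * Y k)))
            ≈⟨ *-congˡ (*-congˡ (trans (∑-*ˡ _ _) (∑-cong λ k → solve 4 (λ κ κ′ x y → (κ :* κ′) :* (x :* y) := (κ :* x) :* (κ′ :* y)) refl κ κ⁻ (X k) (Y k)))) ⟩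
          P p a * (n⁻¹ * ∑[ k < n ] ((κ * X k) * (κ⁻ * Y k)))
            ≈⟨ *-congˡ (*-congˡ (∑-cong λ k → *-cong (eigenvalue-sum a p k) (star-triangle k p r))) ⟩
          P p a * (n⁻¹ * ∑[ k < n ] ((ν * (P⁻ a p * (P p k * U a p k))) * (ν * (P k r * (P⁻ k p * P⁻ p r)))))
            ≈⟨ *-congˡ (*-congˡ (∑-cong collect)) ⟩
          P p a * (n⁻¹ * ∑[ k < n ] ((ν * ν) * ((P⁻ a p * P⁻ p r) * (P k r * U a p k))))
            ≈⟨ *-congˡ (*-congˡ (trans (sym (∑-*ˡ _ _)) (*-congˡ (sym (∑-*ˡ _ _))))) ⟩
          P p a * (n⁻¹ * ((ν * ν) * ((P⁻ a p * P⁻ p r) * ∑[ k < n ] (P k r * U a p k))))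
            ≈⟨ *-congˡ (*-congˡ (*-congˡ (*-congˡ (U-sum a p r)))) ⟩
          P p a * (n⁻¹ * ((ν * ν) * ((P⁻ a p * P⁻ p r) * (ν * (P a r * (P r p * M r p))))))
            ≈⟨ solve 8 (λ x i ν y z w v m → x :* (i :* ((ν :* ν) :* ((y :* z) :* (ν :* (w :* (v :* m))))))
                                         := (ν :* i) :* ((x :* y) :* ((v :* z) :* (ν :* (ν :* (m :* w))))))
                       refl (P p a) n⁻¹ ν (P⁻ a p) (P⁻ p r) (P a r) (P r p) (M r p) ⟩
          (ν * n⁻¹) * ((P p a * P⁻ a p) * ((P r p * P⁻ p r) * (ν * (ν * (M r p * P a r)))))
            ≈⟨ *-unitˡ _ n*n⁻¹≈1 ⟩
          (P p a * P⁻ a p) * ((P r p * P⁻ p r) * (ν * (ν * (M r p * P a r))))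
            ≈⟨ *-unitˡ _ (P-schurᵀ a p) ⟩
          (P r p * P⁻ p r) * (ν * (ν * (M r p * P a r)))
            ≈⟨ *-unitˡ _ (P-schurᵀ p r) ⟩
          ν * (ν * (M r p * P a r))
            ≈⟨ *-congˡ (*-congˡ (*-congˡ (P-symmetric a r))) ⟨
          ν * (ν * (M r p * P r a)) ∎))
          where
          W X Y : Fin n → Carrier
          W c = Q p c * Q⁻ r c
          X k = (Q · θ ᵀ) a k
          Y = Q⁻ *ᵥ W

          reorder : ∑[ c < n ] ((n⁻¹ * (Q · (θ ᵀ · Q⁻)) a c) * W c) ≈ n⁻¹ * ∑[ k < n ] (X k * Y k)
          reorder = begin
            ∑[ c < n ] ((n⁻¹ * (Q · (θ ᵀ · Q⁻)) a c) * W c)  ≈⟨ trans (∑-cong λ c → *-assoc _ _ _) (sym (∑-*ˡ _ _)) ⟩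
            n⁻¹ * ((Q · (θ ᵀ · Q⁻)) *ᵥ W) a               ≈⟨ *-congˡ (*ᵥ-congˡ W (λ i j → sym (·-assoc Q (θ ᵀ) Q⁻ i j)) a) ⟩
            n⁻¹ * (((Q · θ ᵀ) · Q⁻) *ᵥ W) a               ≈⟨ *-congˡ (·-*ᵥ (Q · θ ᵀ) Q⁻ W a) ⟩
            n⁻¹ * ∑[ k < n ] (X k * Y k)                  ∎

          collect : ∀ k → (ν * (P⁻ a p * (P p k * U a p k))) * (ν * (P k r * (P⁻ k p * P⁻ p r)))
                        ≈ (ν * ν) * ((P⁻ a p * P⁻ p r) * (P k r * U a p k))
          collect k = begin
            (ν * (P⁻ a p * (P p k * U a p k))) * (ν * (P k r * (P⁻ k p * P⁻ p r)))
              ≈⟨ solve 7 (λ ν x y u z w v → (ν :* (x :* (y :* u))) :* (ν :* (z :* (w :* v)))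
                                           := (y :* w) :* ((ν :* ν) :* ((x :* v) :* (z :* u))))
                         refl ν (P⁻ a p) (P p k) (U a p k) (P k r) (P⁻ k p) (P⁻ p r) ⟩
            (P p k * P⁻ k p) * ((ν * ν) * ((P⁻ a p * P⁻ p r) * (P k r * U a p k)))
              ≈⟨ *-unitˡ _ (P-schurᵀ k p) ⟩
            (ν * ν) * ((P⁻ a p * P⁻ p r) * (P k r * U a p k)) ∎

    Θ-dual : ∀ {P P⁻ Q Q⁻ M θ : Mat n n} → IsBraidedPair P P⁻ Q Q⁻ → IsΘ P Q M θ →
             IsΘ P⁻ Q⁻ M (n⁻¹ ∙ᴹ (Q · (θ ᵀ · Q⁻)))
    Θ-dual pair Θ = spectralᵀ⇒IsΘ P-schur Q-cols (spectral-transpose pair (IsΘ⇒spectral Q-rows Θ))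
      where open IsBraidedPair pair
            open IsTypeII P-typeII using () renaming (schur to P-schur)
            open IsTypeII Q-typeII using () renaming (rows to Q-rows; cols to Q-cols)

    IsBraidedPair-swap : ∀ {P P⁻ Q Q⁻ : Mat n n} → IsBraidedPair P P⁻ Q Q⁻ → IsBraidedPair P⁻ P Q⁻ Q
    IsBraidedPair-swap pair = record
      { P-symmetric = Symmetric-schurInverse P-symmetric (IsTypeII.schur P-typeII)
      ; P-typeII    = typeII-swap P-typeII
      ; Q-typeII    = typeII-swap Q-typeII
      ; κ           = κ⁻
      ; κ⁻          = κ
      ; κκ⁻≈ν       = trans (*-comm κ⁻ κ) κκ⁻≈ν
      ; braid       = braid⁻
      ; braid⁻      = braid
      }
      where open IsBraidedPair pair

    jonesPair-braided : ∀ {A B A⁻ B⁻ : Mat n n} → IsInvertibleJonesPair A B → Symmetric A →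
                        IsSchurInverse A A⁻ → IsSchurInverse B B⁻ →
                        IsBraidedPair A A⁻ B B⁻ × IsBraidedPair A A⁻ (B ᵀ) (B⁻ ᵀ)
    jonesPair-braided jp@((_ , _ , braidB , braidBᵀ) , _) symA schurA schurB =
        record
          { P-symmetric = symA ; P-typeII = A-typeII ; Q-typeII = B-typeII
          ; κ = 1# ; κ⁻ = ν ; κκ⁻≈ν = *-identityˡ ν
          ; braid = IsΘ-cong (λ _ _ → sym (*-identityˡ _)) ΘB
          ; braid⁻ = braid-inverse symA A-typeII schurB ΘB
          }
      , record
          { P-symmetric = symA ; P-typeII = A-typeII ; Q-typeII = typeII-transpose B-typeII
          ; κ = 1# ; κ⁻ = ν ; κκ⁻≈ν = *-identityˡ ν
          ; braid = IsΘ-cong (λ _ _ → sym (*-identityˡ _)) ΘBᵀ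
          ; braid⁻ = braid-inverse symA A-typeII (λ i j → schurB j i) ΘBᵀ
          }
      where
      A-typeII = proj₁ (jonesPair-typeII jp schurA schurB)
      B-typeII = proj₂ (jonesPair-typeII jp schurA schurB)
      ΘB = braid⇒Θ braidB
      ΘBᵀ = braid⇒Θ braidBᵀ

    Vmat-schurColumns-eigenvector :
      ∀ {A B A⁻ B⁻ : Mat n n} {d} → d * d ≈ ν → IsSchurInverse A A⁻ → IsSchurInverse B B⁻ →
      ∀ {V⁻} → IsSchurInverse (Vmat d A B⁻) V⁻ → (ΘAF ΘBF ΘG ΘGt H K : Mat n n) (λ′ : Fin n → Fin n → Carrier) →
      (∀ i j → (H *ᵥ (col A⁻ j ⊙ᵥ col B⁻ i)) ≈ᵛ (λ′ i j ∙ᵥ (col A⁻ j ⊙ᵥ col B⁻ i))) →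
      (∀ i j → (K *ᵥ (col A i ⊙ᵥ col (B ᵀ) j)) ≈ᵛ (λ′ i j ∙ᵥ (col A i ⊙ᵥ col (B ᵀ) j))) →
      ∀ r s → 2 N.* n N.≤ toℕ r → toℕ s N.< 2 N.* n →
      ∃ λ μ → (Mmat ΘAF ΘBF ΘG ΘGt H K *ᵥ (col (Vmat d A B⁻) r ⊙ᵥ col V⁻ s)) ≈ᵛ (μ ∙ᵥ (col (Vmat d A B⁻) r ⊙ᵥ col V⁻ s))
    Vmat-schurColumns-eigenvector {A} {B} {A⁻} {B⁻} {d} d²≈ν schurA schurB {V⁻} schurV ΘAF ΘBF ΘG ΘGt H K λ′ H-eigen K-eigen r s 2n≤r s<2n
      with FinP.combine-surjective {4} {n} r | FinP.combine-surjective {4} {n} s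
    ... | br , i , ≡.refl | bs , j , ≡.refl =
      λ′ i j + λ′ i j , Mmat-eigenvector ΘAF ΘBF ΘG ΘGt H K (⊙-stacks {u = col (Vmat d A B⁻) (combine br i)} {v = col V⁻ (combine bs j)} V-r V⁻-s)
        (eigenvector-rescale τ⁻¹ (λ k → solve 3 (λ b t a → b :* (t :* a) := t :* (a :* b)) refl (B⁻ k i) τ⁻¹ (A⁻ k j)) (H-eigen i j))
        (eigenvector-rescale σ (λ k → *-assoc σ (A k i) (B j k)) (K-eigen i j))
      where
      open VmatColumns d A B⁻
      σ = proj₁ (right-column br i (quotient-≥ 2 br i 2n≤r))
      V-r = proj₂ (right-column br i (quotient-≥ 2 br i 2n≤r))
      τ = proj₁ (left-column bs j (quotient-< 2 bs j s<2n))
      τ²≈d² = proj₁ (proj₂ (left-column bs j (quotient-< 2 bs j s<2n)))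
      V-s = proj₂ (proj₂ (left-column bs j (quotient-< 2 bs j s<2n)))
      τ⁻¹ = τ * n⁻¹
      ττ⁻¹≈1 : τ * τ⁻¹ ≈ 1#
      ττ⁻¹≈1 = trans (sym (*-assoc τ τ n⁻¹)) (trans (*-congʳ (trans τ²≈d² d²≈ν)) n*n⁻¹≈1)
      scaled-unit : ∀ {a a′ x x′} → a * a′ ≈ 1# → x * x′ ≈ 1# → (a * x) * (a′ * x′) ≈ 1#
      scaled-unit {a} {a′} {x} {x′} aa′≈1 xx′≈1 = trans (solve 4 (λ a a′ x x′ → (a :* x) :* (a′ :* x′) := (a :* a′) :* (x :* x′)) refl a a′ x x′)
                                                        (trans (*-cong aa′≈1 xx′≈1) (*-identityˡ 1#))
      inverseShape : Vec (Vect n) 4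
      inverseShape = τ⁻¹ ∙ᵥ col A⁻ j ∷ -ᵥ (τ⁻¹ ∙ᵥ col A⁻ j) ∷ col (B ᵀ) j ∷ col (B ᵀ) j ∷ []
      V⁻-s : Stacks (col V⁻ (combine bs j)) inverseShape
      V⁻-s = schurInverse-stacks {vs = leftShape τ j} {us = inverseShape} (combine bs j) schurV V-s units
        where
        units : ∀ b k → lookup (leftShape τ j) b k * lookup inverseShape b k ≈ 1#
        units 0F k                   = scaled-unit ττ⁻¹≈1 (schurA k j)
        units 1F k             = trans (-‿*-‿ _ _) (scaled-unit ττ⁻¹≈1 (schurA k j))
        units 2F k       = trans (*-comm _ _) (schurB j k)
        units 3F k = trans (*-comm _ _) (schurB j k)


lemma7p5 : ∀ {c ℓ} (R : CommutativeRing c ℓ) →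
    let open CommutativeRing R
        open Over R
    in IsFieldR → CharZero → AlgClosed →
    (n : ℕ) (A B Ainv Binv : Mat n n) (d : Carrier) →
    IsInvertibleJonesPair A B → Symmetric A →
    IsSchurInverse A Ainv → IsSchurInverse B Binv →
    d * d ≈ fromℕ n →
    (F G H K ΘAF ΘBF ΘG ΘGt ΘH : Mat n n) →
    InN A Ainv F → IsΘ A Ainv F ΘAF → IsΘ Binv B F ΘBF →
    InN A B G → IsΘ A B G ΘG → IsΘ A B (G ᵀ) ΘGt →
    InN A B H → IsΘ A B H ΘH →
    InN A (B ᵀ) (K ᵀ) → IsΘ A (B ᵀ) (K ᵀ) (ΘH ᵀ) →
    (Vinv : Mat (4 N.* n) (4 N.* n)) → IsSchurInverse (Vmat d A Binv) Vinv →
    (r s : Fin (4 N.* n)) → 2 N.* n N.≤ toℕ r → toℕ s N.< 2 N.* n →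
    IsEigenvector (Mmat ΘAF ΘBF ΘG ΘGt H K) (col (Vmat d A Binv) r ⊙ᵥ col Vinv s)
lemma7p5 R isField charZero _ n A B A⁻ B⁻ d jonesPair symA schurA schurB d²≈n F G H K ΘAF ΘBF ΘG ΘGt ΘH
         _ _ _ _ _ _ _ ΘH-of-H _ ΘHᵀ-of-Kᵀ V⁻ schurV r s 2n≤r s<2n =
    (r , schurProduct-nonzero (proj₁ isField) schurV r r s)
  , Vmat-schurColumns-eigenvector d²≈n schurA schurB schurV ΘAF ΘBF ΘG ΘGt H K (λ i j → θ j i)
      (λ i j → H-eigen j i) K-eigen r s 2n≤r s<2n
  where
  open CommutativeRing R
  open Over R
  open JonesPairs R
  n-invertible = size-invertible isField charZero (F.remainder {4} n r)
  n⁻¹ = proj₁ n-invertible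
  open InvertibleSize n n⁻¹ (proj₂ n-invertible)

  AB-braided  = proj₁ (jonesPair-braided jonesPair symA schurA schurB)
  ABᵀ-braided = proj₂ (jonesPair-braided jonesPair symA schurA schurB)

  θ : Mat n n
  θ = n⁻¹ ∙ᴹ (B · (ΘH ᵀ · B⁻))

  H-eigen : IsΘ A⁻ B⁻ H θ
  H-eigen = Θ-dual AB-braided ΘH-of-H

  K-eigen : IsΘ A (B ᵀ) K (θ ᵀ)
  K-eigen = IsΘ-cong (λ i j → *-congˡ (sym (ᵀ-·-· B (ΘH ᵀ) B⁻ i j)))
    (Θ-dual (IsBraidedPair-swap ABᵀ-braided) (Θ-transpose schurA (IsBraidedPair.Q-typeII ABᵀ-braided) ΘHᵀ-of-Kᵀ))
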